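{- Let $\Gamma_1,\dots,\Gamma_8$ be the subgroups of $\mathrm{SL}_2(\mathbf Z)$ generated by the following lists of matrices: \begin{enumerate} \item $\Gamma_{24.6.1^6}$: $\begin{pmatrix}1&0\\24&1\end{pmatrix}, \begin{pmatrix}9&-1\\64&-7\end{pmatrix}, \begin{pmatrix}5&-1\\16&-3\end{pmatrix}, \begin{pmatrix}1&1\\0&1\end{pmatrix}, \begin{pmatrix}-3&-1\\16&5\end{pmatrix}, \begin{pmatrix}-7&-1\\64&9\end{pmatrix}, \begin{pmatrix}-11&-1\\144&13\end{pmatrix}$; \item $\Gamma_{8^32^33^2}$: $\begin{pmatrix}1&3\\0&1\end{pmatrix}, \begin{pmatrix}-7&-8\\8&9\end{pmatrix}, \begin{pmatrix}-3&-2\\8&5\end{pmatrix}, \begin{pmatrix}1&0\\8&1\end{pmatrix}, \begin{pmatrix}5&-2\\8&-3\end{pmatrix}, \begin{pmatrix}9&-8\\8&-7\end{pmatrix}, \begin{pmatrix}13&-18\\8&-11\end{pmatrix}$; \item $\Gamma_{8^36.3.1^3}$: $\begin{pmatrix}-11&6\\-24&13\end{pmatrix}, \begin{pmatrix}41&-25\\64&-39\end{pmatrix}, \begin{pmatrix}49&-32\\72&-47\end{pmatrix}, \begin{pmatrix}1&1\\0&1\end{pmatrix}, \begin{pmatrix}1&0\\8&1\end{pmatrix}, \begin{pmatrix}25&-9\\64&-23\end{pmatrix}, \begin{pmatrix}81&-32\\200&-79\end{pmatrix}$; \item $\Gamma_{24.3.2^3.1^3}$: $\begin{pmatrix}1&0\\24&1\end{pmatrix},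 \begin{pmatrix}21&-2\\200&-19\end{pmatrix}, \begin{pmatrix}9&-1\\64&-7\end{pmatrix}, \begin{pmatrix}5&-2\\8&-3\end{pmatrix}, \begin{pmatrix}1&1\\0&1\end{pmatrix}, \begin{pmatrix}-11&-2\\72&13\end{pmatrix}, \begin{pmatrix}-7&-1\\64&9\end{pmatrix}$; \item $\Gamma_{18.6.3^3.1^3}$: $\begin{pmatrix}1&0\\18&1\end{pmatrix}, \begin{pmatrix}25&-3\\192&-23\end{pmatrix}, \begin{pmatrix}7&-1\\36&-5\end{pmatrix}, \begin{pmatrix}7&-3\\12&-5\end{pmatrix}, \begin{pmatrix}1&1\\0&1\end{pmatrix}, \begin{pmatrix}-11&-3\\48&13\end{pmatrix}, \begin{pmatrix}-5&-1\\36&7\end{pmatrix}$; \item $\Gamma_{9.6^3.3.2^3}$: $\begin{pmatrix}1&3\\0&1\end{pmatrix}, \begin{pmatrix}-5&-6\\6&7\end{pmatrix}, \begin{pmatrix}-11&-8\\18&13\end{pmatrix}, \begin{pmatrix}1&0\\6&1\end{pmatrix}, \begin{pmatrix}7&-2\\18&-5\end{pmatrix}, \begin{pmatrix}7&-6\\6&-5\end{pmatrix}, \begin{pmatrix}25&-32\\18&-23\end{pmatrix}$; \item $\Gamma_{9.6^4.1^3}$: $\begin{pmatrix}-17&6\\-54&19\end{pmatrix}, \begin{pmatrix}127&-49\\324&-125\end{pmatrix}, \begin{pmatrix}61&-24\\150&-59\end{pmatrix}, \begin{pmatrix}1&1\\0&1\end{pmatrix}, \begin{pmatrix}1&0\\6&1\end{pmatrix},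 \begin{pmatrix}91&-25\\324&-89\end{pmatrix}, \begin{pmatrix}85&-24\\294&-83\end{pmatrix}$; \item $\Gamma_{18.3^4.2^3}$: $\begin{pmatrix}1&3\\0&1\end{pmatrix}, \begin{pmatrix}-11&-8\\18&13\end{pmatrix}, \begin{pmatrix}-5&-3\\12&7\end{pmatrix}, \begin{pmatrix}7&-2\\18&-5\end{pmatrix}, \begin{pmatrix}7&-3\\12&-5\end{pmatrix}, \begin{pmatrix}25&-32\\18&-23\end{pmatrix}, \begin{pmatrix}19&-27\\12&-17\end{pmatrix}$. \end{enumerate} Then each of these eight groups is a noncongruence subgroup of $\mathrm{SL}_2(\mathbf Z)$, i.e. for every integer $N\ge 1$ it does not contain the principal congruence subgroup $\Gamma(N)=\{\gamma\in \mathrm{SL}_2(\mathbf Z): \gamma\equiv I \bmod N\}$.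
   Context: A finite index subgroup of $\mathrm{SL}_2(\mathbf Z)$ is called noncongruence if it does not contain $\Gamma(N)$ for any $N\ge 1$. In the paper, the first four groups are described as index $3$ genus $0$ subgroups of $\Gamma_0(8)\cap\Gamma_1(4)$ and the last four as index $3$ genus $0$ subgroups of $\Gamma_1(6)$; the subscripts are merely names of the groups. -}

module Defs where

open import Data.Nat using (ℕ; _≥_)
open import Data.Integer using (ℤ; +_; _+_; _-_; _*_; -_)
open import Data.Integer.Divisibility using (_∣_)
open import Data.Integer.Literals as Lit
open import Agda.Builtin.FromNat
open import Agda.Builtin.FromNeg
open import Data.Unit using (⊤; tt)
open import Data.Fin using (Fin; zero; suc)
open import Data.List using (List; []; _∷_)
open import Data.List.Membership.Propositional using (_∈_)
open import Data.Product using (_×_)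
open import Relation.Binary.PropositionalEquality using (_≡_)
open import Relation.Nullary using (¬_)

import Data.Nat.Literals as NLit

instance
  ℕ-number : Number ℕ
  ℕ-number = NLit.number
  ℤ-number : Number ℤ
  ℤ-number = Lit.number
  ℤ-negative : Negative ℤ
  ℤ-negative = Lit.negative

record Mat : Set where
  constructor mat
  field
    a b c d : ℤ
open Mat public

det : Mat → ℤ
det (mat a b c d) = a * d - b * c

infixl 7 _⊗_
_⊗_ : Mat → Mat → Mat
mat a b c d ⊗ mat a' b' c' d' =
  mat (a * a' + b * c') (a * b' + b * d') (c * a' + d * c') (c * b' + d * d')

I : Mat
I = mat 1 0 0 1

-- adjugate; equals the inverse for matrices of determinant 1 (all generators below)
inv : Mat → Mat
inv (mat a b c d) = mat d (- b) (- c) a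

SL2 : Mat → Set
SL2 m = det m ≡ 1

data ⟨_⟩ (gs : List Mat) : Mat → Set where
  gen-id  : ⟨ gs ⟩ I
  gen-mul : ∀ {g m} → g ∈ gs → ⟨ gs ⟩ m → ⟨ gs ⟩ (g ⊗ m)
  gen-inv : ∀ {g m} → g ∈ gs → ⟨ gs ⟩ m → ⟨ gs ⟩ (inv g ⊗ m)

PrincipalCongruence : ℕ → Mat → Set
PrincipalCongruence N m =
  SL2 m × ((+ N) ∣ (a m - 1)) × ((+ N) ∣ b m) × ((+ N) ∣ c m) × ((+ N) ∣ (d m - 1))

Noncongruence : List Mat → Set
Noncongruence gs = ∀ (N : ℕ) → N ≥ 1 → ¬ (∀ m → PrincipalCongruence N m → ⟨ gs ⟩ m)

Γgens : Fin 8 → List Mat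
Γgens zero =
  mat 1 0 24 1 ∷ mat 9 -1 64 -7 ∷ mat 5 -1 16 -3 ∷ mat 1 1 0 1 ∷
  mat -3 -1 16 5 ∷ mat -7 -1 64 9 ∷ mat -11 -1 144 13 ∷ []
Γgens (suc zero) =
  mat 1 3 0 1 ∷ mat -7 -8 8 9 ∷ mat -3 -2 8 5 ∷ mat 1 0 8 1 ∷
  mat 5 -2 8 -3 ∷ mat 9 -8 8 -7 ∷ mat 13 -18 8 -11 ∷ []
Γgens (suc (suc zero)) =
  mat -11 6 -24 13 ∷ mat 41 -25 64 -39 ∷ mat 49 -32 72 -47 ∷ mat 1 1 0 1 ∷
  mat 1 0 8 1 ∷ mat 25 -9 64 -23 ∷ mat 81 -32 200 -79 ∷ []
Γgens (suc (suc (suc zero))) =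
  mat 1 0 24 1 ∷ mat 21 -2 200 -19 ∷ mat 9 -1 64 -7 ∷ mat 5 -2 8 -3 ∷
  mat 1 1 0 1 ∷ mat -11 -2 72 13 ∷ mat -7 -1 64 9 ∷ []
Γgens (suc (suc (suc (suc zero)))) =
  mat 1 0 18 1 ∷ mat 25 -3 192 -23 ∷ mat 7 -1 36 -5 ∷ mat 7 -3 12 -5 ∷
  mat 1 1 0 1 ∷ mat -11 -3 48 13 ∷ mat -5 -1 36 7 ∷ []
Γgens (suc (suc (suc (suc (suc zero))))) =
  mat 1 3 0 1 ∷ mat -5 -6 6 7 ∷ mat -11 -8 18 13 ∷ mat 1 0 6 1 ∷
  mat 7 -2 18 -5 ∷ mat 7 -6 6 -5 ∷ mat 25 -32 18 -23 ∷ []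
Γgens (suc (suc (suc (suc (suc (suc zero)))))) =
  mat -17 6 -54 19 ∷ mat 127 -49 324 -125 ∷ mat 61 -24 150 -59 ∷ mat 1 1 0 1 ∷
  mat 1 0 6 1 ∷ mat 91 -25 324 -89 ∷ mat 85 -24 294 -83 ∷ []
Γgens (suc (suc (suc (suc (suc (suc (suc zero))))))) =
  mat 1 3 0 1 ∷ mat -11 -8 18 13 ∷ mat -5 -3 12 7 ∷ mat 7 -2 18 -5 ∷
  mat 7 -3 12 -5 ∷ mat 25 -32 18 -23 ∷ mat 19 -27 12 -17 ∷ []

module Submission where

-- Each group Γ is shown to be noncongruence using a permutation representation
-- of SL₂(ℤ) on 72 points, given by tables, in which Γ fixes a base point x₀.
--
-- 1. Maps σS, σT satisfying S⁴ = 1, S²T = TS², TSTST = S let words in S and T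
--    act, and words with equal matrices act equally (`⟦⟧-determines-action`).
--    The proof uses the normal form Sᵏ P Sʲ, with P in the monoid SL₂(ℕ), which
--    is free on T and L = TST.
-- 2. If T^w and L^w act trivially and a word for some E ≡ I (mod w) moves x₀,
--    then for each N ≥ 1, conjugating E and clearing its off-diagonal entries
--    with powers of T^w and L^w gives a word that acts like E and whose matrix
--    lies in Γ(N); hence Γ ⊉ Γ(N) (`noncongruence-criterion`).  The number
--    theory needed is Bézout's identity and a shift making γ + hα prime to N.
-- 3. On Fin n these hypotheses are decidable; a `Certificate` holds the tables,
--    w and E, and `certified` checks it by evaluation.

open import Defs
open import Agda.Builtin.FromNat
open import Agda.Builtin.FromNeg
open import Data.Unit using (tt)
open import Data.Empty using (⊥-elim)
open import Data.Product using (Σ; ∃; _×_; _,_; proj₁; proj₂)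
open import Data.Sum using (_⊎_; inj₁; inj₂)
open import Data.Nat as ℕ using (ℕ; zero; suc)
import Data.Nat.Properties as ℕ
import Data.Nat.Divisibility as ℕ
open import Data.Nat.Divisibility using (_∣_; divides; ∣-trans; ∣1⇒≡1; ∣m+n∣m⇒∣n)
open import Data.Nat.GCD using (gcd; gcd[m,n]∣m; gcd[m,n]∣n; gcd[m,n]≢0; module Bézout)
open import Data.Nat.Coprimality as Coprimality using (Coprime; gcd≡1⇒coprime; coprime-divisor; coprime?)
open import Data.Nat.Induction using (<-rec)
open import Data.Integer as ℤ using (ℤ; +_; -[1+_]; _+_; _-_; _*_; -_; _/_)
import Data.Integer.Properties as ℤ
open import Data.Integer.Divisibility.Signed
  using (quotient; ∣m∣n⇒∣m+n; ∣m∣n⇒∣m-n; ∣n⇒∣m*n; ∣m⇒∣m*n; ∣m⇒∣-m; ∣⇒∣ᵤ)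
  renaming (_∣_ to _∣ᶻ_; divides to dividesᶻ; _∣?_ to _∣ᶻ?_)
open import Data.Integer.Tactic.RingSolver using (solve-∀)
open import Data.Fin as Fin using (Fin)
import Data.Fin.Literals as FinLiterals
import Data.Fin.Properties as Fin
open import Data.Vec using (Vec; []; _∷_; lookup)
open import Data.List using (List; []; _∷_; _++_)
open import Data.List.Properties using (++-assoc)
open import Data.List.Membership.Propositional using (_∈_)
open import Data.List.Relation.Unary.All as All using (All)
open import Function using (_∘′_)
open import Relation.Nullary using (Dec; ¬_)
open import Relation.Nullary.Decidable using (True; toWitness; _×-dec_; ¬?; map′; yes; no)
open import Relation.Binary.Definitions using (DecidableEquality)
open import Relation.Binary.PropositionalEquality

instance
  Fin-number : ∀ {n} → Number (Fin n)
  Fin-number {n} = FinLiterals.number n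

mat-cong : ∀ {x y z t x′ y′ z′ t′ : ℤ} →
           x ≡ x′ → y ≡ y′ → z ≡ z′ → t ≡ t′ → mat x y z t ≡ mat x′ y′ z′ t′
mat-cong refl refl refl refl = refl

⊗-assoc : ∀ A B C → A ⊗ (B ⊗ C) ≡ (A ⊗ B) ⊗ C
⊗-assoc (mat p q r s) (mat e f g h) (mat i j k l) =
  mat-cong (entry p q e f g h i k) (entry p q e f g h j l) (entry r s e f g h i k) (entry r s e f g h j l)
  where
  entry : ∀ (p q e f g h i k : ℤ) →
          p * (e * i + f * k) + q * (g * i + h * k) ≡ (p * e + q * g) * i + (p * f + q * h) * k
  entry = solve-∀

⊗-identityˡ : ∀ M → I ⊗ M ≡ M
⊗-identityˡ (mat p q r s) = mat-cong (top p r) (top q s) (bottom p r) (bottom q s)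
  where
  top : ∀ (x y : ℤ) → 1 * x + 0 * y ≡ x
  top = solve-∀
  bottom : ∀ (x y : ℤ) → 0 * x + 1 * y ≡ y
  bottom = solve-∀

det-⊗ : ∀ A B → det (A ⊗ B) ≡ det A * det B
det-⊗ (mat p q r s) (mat e f g h) = expand p q r s e f g h
  where
  expand : ∀ (p q r s e f g h : ℤ) →
           (p * e + q * g) * (r * f + s * h) - (p * f + q * h) * (r * e + s * g) ≡ (p * s - q * r) * (e * h - f * g)
  expand = solve-∀

data Letter : Set where
  𝕊 𝕋 : Letter

Smat Tmat : Mat
Smat = mat 0 -1 1 0
Tmat = mat 1 1 0 1

letter : Letter → Mat
letter 𝕊 = Smat
letter 𝕋 = Tmat

⟦_⟧ : List Letter → Mat
⟦ [] ⟧ = I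
⟦ l ∷ u ⟧ = letter l ⊗ ⟦ u ⟧

⟦⟧-++ : ∀ u v → ⟦ u ++ v ⟧ ≡ ⟦ u ⟧ ⊗ ⟦ v ⟧
⟦⟧-++ [] v = sym (⊗-identityˡ ⟦ v ⟧)
⟦⟧-++ (l ∷ u) v = trans (cong (letter l ⊗_) (⟦⟧-++ u v)) (⊗-assoc (letter l) ⟦ u ⟧ ⟦ v ⟧)

det-⟦⟧ : ∀ u → det ⟦ u ⟧ ≡ 1
det-⟦⟧ [] = refl
det-⟦⟧ (l ∷ u) = trans (det-⊗ (letter l) ⟦ u ⟧) (trans (cong (det (letter l) *_) (det-⟦⟧ u)) (det-letter l))
  where
  det-letter : ∀ l → det (letter l) * 1 ≡ 1
  det-letter 𝕊 = refl
  det-letter 𝕋 = refl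

-- Two maps σS, σT on X make words act on X from the right, letter by letter:
-- x · l₁ l₂ … lₙ = (…(x · l₁) · l₂ …) · lₙ.
act : {X : Set} → (X → X) → (X → X) → List Letter → X → X
act σS σT [] x = x
act σS σT (𝕊 ∷ u) x = act σS σT u (σS x)
act σS σT (𝕋 ∷ u) x = act σS σT u (σT x)

act-++ : ∀ {X : Set} (σS σT : X → X) u v x → act σS σT (u ++ v) x ≡ act σS σT v (act σS σT u x)
act-++ σS σT [] v x = refl
act-++ σS σT (𝕊 ∷ u) v x = act-++ σS σT u v (σS x)
act-++ σS σT (𝕋 ∷ u) v x = act-++ σS σT u v (σT x)

record SL₂Action (X : Set) : Set where
  field
    σS σT : X → X

  infixl 5 _·_
  _·_ : X → List Letter → X
  x · u = act σS σT u x

  field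
    S⁴≈1    : ∀ x → x · (𝕊 ∷ 𝕊 ∷ 𝕊 ∷ 𝕊 ∷ []) ≡ x
    S²T≈TS² : ∀ x → x · (𝕊 ∷ 𝕊 ∷ 𝕋 ∷ []) ≡ x · (𝕋 ∷ 𝕊 ∷ 𝕊 ∷ [])
    TSTST≈S : ∀ x → x · (𝕋 ∷ 𝕊 ∷ 𝕋 ∷ 𝕊 ∷ 𝕋 ∷ []) ≡ x · (𝕊 ∷ [])

  ·-++ : ∀ x u v → x · (u ++ v) ≡ x · u · v
  ·-++ x u v = act-++ σS σT u v x

-- The monoid SL₂(ℕ): products of T and L = TST = (1 0; 1 1), computed in ℕ.

record ℕMat : Set where
  constructor nmat
  field
    na nb nc nd : ℕ
open ℕMat

nmat-cong : ∀ {x y z t x′ y′ z′ t′ : ℕ} →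
            x ≡ x′ → y ≡ y′ → z ≡ z′ → t ≡ t′ → nmat x y z t ≡ nmat x′ y′ z′ t′
nmat-cong refl refl refl refl = refl

data PLetter : Set where
  𝕋⁺ 𝕃⁺ : PLetter

T·_ L·_ : ℕMat → ℕMat
T· nmat p q r s = nmat (p ℕ.+ r) (q ℕ.+ s) r s
L· nmat p q r s = nmat p q (p ℕ.+ r) (q ℕ.+ s)

⟦_⟧₊ : List PLetter → ℕMat
⟦ [] ⟧₊ = nmat 1 0 0 1
⟦ 𝕋⁺ ∷ w ⟧₊ = T· ⟦ w ⟧₊
⟦ 𝕃⁺ ∷ w ⟧₊ = L· ⟦ w ⟧₊

PositiveDiagonal : ℕMat → Set
PositiveDiagonal M = 0 ℕ.< na M × 0 ℕ.< nd M

IsDiagonal : ℕMat → Set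
IsDiagonal M = nb M ≡ 0 × nc M ≡ 0

⟦⟧₊-positive : ∀ w → PositiveDiagonal ⟦ w ⟧₊
⟦⟧₊-positive [] = ℕ.s≤s ℕ.z≤n , ℕ.s≤s ℕ.z≤n
⟦⟧₊-positive (𝕋⁺ ∷ w) with ⟦ w ⟧₊ | ⟦⟧₊-positive w
... | nmat p q r s | p>0 , s>0 = ℕ.<-≤-trans p>0 (ℕ.m≤m+n p r) , s>0
⟦⟧₊-positive (𝕃⁺ ∷ w) with ⟦ w ⟧₊ | ⟦⟧₊-positive w
... | nmat p q r s | p>0 , s>0 = p>0 , ℕ.<-≤-trans s>0 (ℕ.m≤n+m s q)

-- Only the empty product is diagonal, since a letter makes an off-diagonal entry positive.
⟦⟧₊-diagonal : ∀ w → IsDiagonal ⟦ w ⟧₊ → w ≡ []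
⟦⟧₊-diagonal [] _ = refl
⟦⟧₊-diagonal (𝕋⁺ ∷ w) (q+s≡0 , _) with ⟦ w ⟧₊ | ⟦⟧₊-positive w
... | nmat p q r s | _ , s>0 = ⊥-elim (ℕ.n>0⇒n≢0 s>0 (ℕ.m+n≡0⇒n≡0 q q+s≡0))
⟦⟧₊-diagonal (𝕃⁺ ∷ w) (_ , p+r≡0) with ⟦ w ⟧₊ | ⟦⟧₊-positive w
... | nmat p q r s | p>0 , _ = ⊥-elim (ℕ.n>0⇒n≢0 p>0 (ℕ.m+n≡0⇒m≡0 p p+r≡0))

-- T·M ≠ L·M′: otherwise r = (p + r) + r′ with p > 0.
T·≢L· : ∀ {M M′} → 0 ℕ.< na M → T· M ≢ L· M′
T·≢L· {nmat p q r s} {nmat p′ q′ r′ s′} p>0 eq = ℕ.<-irrefl refl r<r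
  where
  r<r : r ℕ.< r
  r<r = ℕ.<-≤-trans (ℕ.+-monoˡ-< r p>0)
          (ℕ.≤-trans (ℕ.m≤m+n (p ℕ.+ r) r′) (ℕ.≤-reflexive (sym (trans (cong nc eq) (cong (ℕ._+ r′) (sym (cong na eq)))))))

T·-injective : ∀ {M M′} → T· M ≡ T· M′ → M ≡ M′
T·-injective {nmat p q r s} {nmat p′ q′ r′ s′} eq with cong nc eq | cong nd eq
... | refl | refl = nmat-cong (ℕ.+-cancelʳ-≡ r p p′ (cong na eq)) (ℕ.+-cancelʳ-≡ s q q′ (cong nb eq)) refl refl

L·-injective : ∀ {M M′} → L· M ≡ L· M′ → M ≡ M′
L·-injective {nmat p q r s} {nmat p′ q′ r′ s′} eq with cong na eq | cong nb eq
... | refl | refl = nmat-cong refl refl (ℕ.+-cancelˡ-≡ p r r′ (cong nc eq)) (ℕ.+-cancelˡ-≡ q s s′ (cong nd eq))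

⟦⟧₊-injective : ∀ w w′ → ⟦ w ⟧₊ ≡ ⟦ w′ ⟧₊ → w ≡ w′
⟦⟧₊-injective [] w′ eq = sym (⟦⟧₊-diagonal w′ (sym (cong nb eq) , sym (cong nc eq)))
⟦⟧₊-injective w@(_ ∷ _) [] eq = ⟦⟧₊-diagonal w (cong nb eq , cong nc eq)
⟦⟧₊-injective (𝕋⁺ ∷ w) (𝕋⁺ ∷ w′) eq = cong (𝕋⁺ ∷_) (⟦⟧₊-injective w w′ (T·-injective eq))
⟦⟧₊-injective (𝕃⁺ ∷ w) (𝕃⁺ ∷ w′) eq = cong (𝕃⁺ ∷_) (⟦⟧₊-injective w w′ (L·-injective eq))
⟦⟧₊-injective (𝕋⁺ ∷ w) (𝕃⁺ ∷ w′) eq = ⊥-elim (T·≢L· (proj₁ (⟦⟧₊-positive w)) eq)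
⟦⟧₊-injective (𝕃⁺ ∷ w) (𝕋⁺ ∷ w′) eq = ⊥-elim (T·≢L· (proj₁ (⟦⟧₊-positive w′)) (sym eq))

-- Normal forms Sᵏ · Q · Sʲ with k mod 4, j ∈ {0, 1} and Q ∈ SL₂(ℕ).

data K4 : Set where
  k0 k1 k2 k3 : K4

data J2 : Set where
  j0 j1 : J2

sucK : K4 → K4
sucK k0 = k1
sucK k1 = k2
sucK k2 = k3
sucK k3 = k0

-- The matrix Sᵏ · Q · Sʲ, written out entrywise.
shape : K4 → J2 → ℕMat → Mat
shape k0 j0 (nmat p q r s) = mat (+ p) (+ q) (+ r) (+ s)
shape k1 j0 (nmat p q r s) = mat (- + r) (- + s) (+ p) (+ q)
shape k2 j0 (nmat p q r s) = mat (- + p) (- + q) (- + r) (- + s)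
shape k3 j0 (nmat p q r s) = mat (+ r) (+ s) (- + p) (- + q)
shape k0 j1 (nmat p q r s) = mat (+ q) (- + p) (+ s) (- + r)
shape k1 j1 (nmat p q r s) = mat (- + s) (+ r) (+ q) (- + p)
shape k2 j1 (nmat p q r s) = mat (- + q) (+ p) (- + s) (+ r)
shape k3 j1 (nmat p q r s) = mat (+ s) (- + r) (- + q) (+ p)

-- Sᵏ Sʲ = Sᵏ′ Sʲ′ with j ≠ j′.
data SamePower : K4 → J2 → K4 → J2 → Set where
  shift₀₁ : ∀ {k} → SamePower (sucK k) j0 k j1
  shift₁₀ : ∀ {k} → SamePower k j1 (sucK k) j0

-- The possible reasons for Sᵏ Q Sʲ = Sᵏ′ Q′ Sʲ′: equal data, or Q and Q′ are
-- diagonal (hence I) and the powers of S agree.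
Agree : K4 → J2 → K4 → J2 → ℕMat → ℕMat → Set
Agree k j k′ j′ Q Q′ =
  (k ≡ k′ × j ≡ j′ × Q ≡ Q′) ⊎ (SamePower k j k′ j′ × IsDiagonal Q × IsDiagonal Q′)

+suc≢-+ : ∀ {n m} → + suc n ≢ - (+ m)
+suc≢-+ {m = zero} ()
+suc≢-+ {m = suc m} ()

-[1+]≢+ : ∀ {n m} → -[1+ n ] ≢ + m
-[1+]≢+ ()

+≢-[1+] : ∀ {n m} → + m ≢ -[1+ n ]
+≢-[1+] ()

+≡-+⇒0 : ∀ {m n} → + m ≡ - (+ n) → m ≡ 0 × n ≡ 0
+≡-+⇒0 {zero} {zero} refl = refl , refl

pos-injective : ∀ {m n} → + m ≡ + n → m ≡ n
pos-injective = ℤ.+-injective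

neg-injective : ∀ {m n} → - (+ m) ≡ - (+ n) → m ≡ n
neg-injective eq = ℤ.+-injective (ℤ.neg-injective eq)

shape-injective₁ : ∀ k j {Q Q′} → shape k j Q ≡ shape k j Q′ → Q ≡ Q′
shape-injective₁ k0 j0 eq = nmat-cong (pos-injective (cong a eq)) (pos-injective (cong b eq)) (pos-injective (cong c eq)) (pos-injective (cong d eq))
shape-injective₁ k1 j0 eq = nmat-cong (pos-injective (cong c eq)) (pos-injective (cong d eq)) (neg-injective (cong a eq)) (neg-injective (cong b eq))
shape-injective₁ k2 j0 eq = nmat-cong (neg-injective (cong a eq)) (neg-injective (cong b eq)) (neg-injective (cong c eq)) (neg-injective (cong d eq))
shape-injective₁ k3 j0 eq = nmat-cong (neg-injective (cong c eq)) (neg-injective (cong d eq)) (pos-injective (cong a eq)) (pos-injective (cong b eq))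
shape-injective₁ k0 j1 eq = nmat-cong (neg-injective (cong b eq)) (pos-injective (cong a eq)) (neg-injective (cong d eq)) (pos-injective (cong c eq))
shape-injective₁ k1 j1 eq = nmat-cong (neg-injective (cong d eq)) (pos-injective (cong c eq)) (pos-injective (cong b eq)) (neg-injective (cong a eq))
shape-injective₁ k2 j1 eq = nmat-cong (pos-injective (cong b eq)) (neg-injective (cong a eq)) (pos-injective (cong d eq)) (neg-injective (cong c eq))
shape-injective₁ k3 j1 eq = nmat-cong (pos-injective (cong d eq)) (neg-injective (cong c eq)) (neg-injective (cong b eq)) (pos-injective (cong a eq))

-- For Q with positive diagonal the entries of
-- Sᵏ Q Sʲ coming from the diagonal of Q have a sign pattern determined by
-- (k, j); comparing sign patterns, two shapes can only agree in the ways
-- listed in `Agree`.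
shape-injective : ∀ k j k′ j′ {Q Q′} → PositiveDiagonal Q → PositiveDiagonal Q′ →
                  shape k j Q ≡ shape k′ j′ Q′ → Agree k j k′ j′ Q Q′
shape-injective k j k′ j′ {nmat _ _ _ _} {nmat _ _ _ _} (ℕ.s≤s ℕ.z≤n , ℕ.s≤s ℕ.z≤n) (ℕ.s≤s ℕ.z≤n , ℕ.s≤s ℕ.z≤n) =
  core k j k′ j′
  where
  core : ∀ k j k′ j′ {p q r s p′ q′ r′ s′} →
         shape k j (nmat (suc p) q r (suc s)) ≡ shape k′ j′ (nmat (suc p′) q′ r′ (suc s′)) →
         Agree k j k′ j′ (nmat (suc p) q r (suc s)) (nmat (suc p′) q′ r′ (suc s′))
  core k0 j0 k0 j0 eq = inj₁ (refl , refl , shape-injective₁ k0 j0 eq)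
  core k0 j0 k1 j0 eq = ⊥-elim (+suc≢-+ (cong a eq))
  core k0 j0 k2 j0 eq = ⊥-elim (+suc≢-+ (cong a eq))
  core k0 j0 k3 j0 eq = ⊥-elim (+≢-[1+] (cong c eq))
  core k0 j0 k0 j1 eq = ⊥-elim (+≢-[1+] (cong b eq))
  core k0 j0 k1 j1 eq = ⊥-elim (+suc≢-+ (cong a eq))
  core k0 j0 k2 j1 eq = ⊥-elim (+suc≢-+ (cong a eq))
  core k0 j0 k3 j1 eq = inj₂ (shift₀₁ , (proj₁ (+≡-+⇒0 (cong b eq)) , proj₁ (+≡-+⇒0 (cong c eq))) , (proj₂ (+≡-+⇒0 (cong c eq)) , proj₂ (+≡-+⇒0 (cong b eq))))
  core k1 j0 k0 j0 eq = ⊥-elim (+suc≢-+ (sym (cong a eq)))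
  core k1 j0 k1 j0 eq = inj₁ (refl , refl , shape-injective₁ k1 j0 eq)
  core k1 j0 k2 j0 eq = ⊥-elim (+suc≢-+ (cong c eq))
  core k1 j0 k3 j0 eq = ⊥-elim (-[1+]≢+ (cong b eq))
  core k1 j0 k0 j1 eq = inj₂ (shift₀₁ , (proj₁ (+≡-+⇒0 (cong d eq)) , proj₂ (+≡-+⇒0 (sym (cong a eq)))) , (proj₁ (+≡-+⇒0 (sym (cong a eq))) , proj₂ (+≡-+⇒0 (cong d eq))))
  core k1 j0 k1 j1 eq = ⊥-elim (-[1+]≢+ (cong b eq))
  core k1 j0 k2 j1 eq = ⊥-elim (-[1+]≢+ (cong b eq))
  core k1 j0 k3 j1 eq = ⊥-elim (+suc≢-+ (sym (cong a eq)))
  core k2 j0 k0 j0 eq = ⊥-elim (-[1+]≢+ (cong a eq))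
  core k2 j0 k1 j0 eq = ⊥-elim (+suc≢-+ (sym (cong c eq)))
  core k2 j0 k2 j0 eq = inj₁ (refl , refl , shape-injective₁ k2 j0 eq)
  core k2 j0 k3 j0 eq = ⊥-elim (-[1+]≢+ (cong a eq))
  core k2 j0 k0 j1 eq = ⊥-elim (-[1+]≢+ (cong a eq))
  core k2 j0 k1 j1 eq = inj₂ (shift₀₁ , (proj₂ (+≡-+⇒0 (sym (cong b eq))) , proj₂ (+≡-+⇒0 (sym (cong c eq)))) , (proj₁ (+≡-+⇒0 (sym (cong c eq))) , proj₁ (+≡-+⇒0 (sym (cong b eq)))))
  core k2 j0 k2 j1 eq = ⊥-elim (+suc≢-+ (sym (cong b eq)))
  core k2 j0 k3 j1 eq = ⊥-elim (-[1+]≢+ (cong a eq))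
  core k3 j0 k0 j0 eq = ⊥-elim (-[1+]≢+ (cong c eq))
  core k3 j0 k1 j0 eq = ⊥-elim (+suc≢-+ (cong b eq))
  core k3 j0 k2 j0 eq = ⊥-elim (+≢-[1+] (cong a eq))
  core k3 j0 k3 j0 eq = inj₁ (refl , refl , shape-injective₁ k3 j0 eq)
  core k3 j0 k0 j1 eq = ⊥-elim (+suc≢-+ (cong b eq))
  core k3 j0 k1 j1 eq = ⊥-elim (+≢-[1+] (cong a eq))
  core k3 j0 k2 j1 eq = inj₂ (shift₀₁ , (proj₂ (+≡-+⇒0 (sym (cong d eq))) , proj₁ (+≡-+⇒0 (cong a eq))) , (proj₂ (+≡-+⇒0 (cong a eq)) , proj₁ (+≡-+⇒0 (sym (cong d eq)))))
  core k3 j0 k3 j1 eq = ⊥-elim (+suc≢-+ (cong b eq))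
  core k0 j1 k0 j0 eq = ⊥-elim (-[1+]≢+ (cong b eq))
  core k0 j1 k1 j0 eq = inj₂ (shift₁₀ , (proj₁ (+≡-+⇒0 (cong a eq)) , proj₂ (+≡-+⇒0 (sym (cong d eq)))) , (proj₁ (+≡-+⇒0 (sym (cong d eq))) , proj₂ (+≡-+⇒0 (cong a eq))))
  core k0 j1 k2 j0 eq = ⊥-elim (+≢-[1+] (cong a eq))
  core k0 j1 k3 j0 eq = ⊥-elim (-[1+]≢+ (cong b eq))
  core k0 j1 k0 j1 eq = inj₁ (refl , refl , shape-injective₁ k0 j1 eq)
  core k0 j1 k1 j1 eq = ⊥-elim (+≢-[1+] (cong a eq))
  core k0 j1 k2 j1 eq = ⊥-elim (-[1+]≢+ (cong b eq))
  core k0 j1 k3 j1 eq = ⊥-elim (+suc≢-+ (cong c eq))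
  core k1 j1 k0 j0 eq = ⊥-elim (-[1+]≢+ (cong a eq))
  core k1 j1 k1 j0 eq = ⊥-elim (+≢-[1+] (cong b eq))
  core k1 j1 k2 j0 eq = inj₂ (shift₁₀ , (proj₁ (+≡-+⇒0 (cong c eq)) , proj₁ (+≡-+⇒0 (cong b eq))) , (proj₂ (+≡-+⇒0 (cong b eq)) , proj₂ (+≡-+⇒0 (cong c eq))))
  core k1 j1 k3 j0 eq = ⊥-elim (-[1+]≢+ (cong a eq))
  core k1 j1 k0 j1 eq = ⊥-elim (-[1+]≢+ (cong a eq))
  core k1 j1 k1 j1 eq = inj₁ (refl , refl , shape-injective₁ k1 j1 eq)
  core k1 j1 k2 j1 eq = ⊥-elim (+≢-[1+] (cong c eq))
  core k1 j1 k3 j1 eq = ⊥-elim (-[1+]≢+ (cong a eq))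
  core k2 j1 k0 j0 eq = ⊥-elim (+suc≢-+ (sym (cong a eq)))
  core k2 j1 k1 j0 eq = ⊥-elim (+suc≢-+ (cong b eq))
  core k2 j1 k2 j0 eq = ⊥-elim (+suc≢-+ (cong b eq))
  core k2 j1 k3 j0 eq = inj₂ (shift₁₀ , (proj₂ (+≡-+⇒0 (sym (cong a eq))) , proj₁ (+≡-+⇒0 (cong d eq))) , (proj₂ (+≡-+⇒0 (cong d eq)) , proj₁ (+≡-+⇒0 (sym (cong a eq)))))
  core k2 j1 k0 j1 eq = ⊥-elim (+suc≢-+ (cong b eq))
  core k2 j1 k1 j1 eq = ⊥-elim (-[1+]≢+ (cong c eq))
  core k2 j1 k2 j1 eq = inj₁ (refl , refl , shape-injective₁ k2 j1 eq)
  core k2 j1 k3 j1 eq = ⊥-elim (+suc≢-+ (sym (cong a eq)))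
  core k3 j1 k0 j0 eq = inj₂ (shift₁₀ , (proj₂ (+≡-+⇒0 (sym (cong c eq))) , proj₂ (+≡-+⇒0 (sym (cong b eq)))) , (proj₁ (+≡-+⇒0 (sym (cong b eq))) , proj₁ (+≡-+⇒0 (sym (cong c eq)))))
  core k3 j1 k1 j0 eq = ⊥-elim (+suc≢-+ (cong a eq))
  core k3 j1 k2 j0 eq = ⊥-elim (+suc≢-+ (cong a eq))
  core k3 j1 k3 j0 eq = ⊥-elim (+suc≢-+ (sym (cong b eq)))
  core k3 j1 k0 j1 eq = ⊥-elim (+suc≢-+ (sym (cong c eq)))
  core k3 j1 k1 j1 eq = ⊥-elim (+suc≢-+ (cong a eq))
  core k3 j1 k2 j1 eq = ⊥-elim (+suc≢-+ (cong a eq))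
  core k3 j1 k3 j1 eq = inj₁ (refl , refl , shape-injective₁ k3 j1 eq)

S⊗ : ∀ x y z t {z′ t′} → - z ≡ z′ → - t ≡ t′ → Smat ⊗ mat x y z t ≡ mat z′ t′ x y
S⊗ x y z t refl refl = mat-cong (top z x) (top t y) (bottom x z) (bottom y t)
  where
  top : ∀ (z x : ℤ) → 0 * x + -1 * z ≡ - z
  top = solve-∀
  bottom : ∀ (x z : ℤ) → 1 * x + 0 * z ≡ x
  bottom = solve-∀

T⊗ : ∀ x y z t {x′ y′} → x + z ≡ x′ → y + t ≡ y′ → Tmat ⊗ mat x y z t ≡ mat x′ y′ z t
T⊗ x y z t refl refl = mat-cong (top x z) (top y t) (bottom x z) (bottom y t)
  where
  top : ∀ (x z : ℤ) → 1 * x + 1 * z ≡ x + z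
  top = solve-∀
  bottom : ∀ (x z : ℤ) → 0 * x + 1 * z ≡ z
  bottom = solve-∀

S-shape : ∀ k j Q → Smat ⊗ shape k j Q ≡ shape (sucK k) j Q
S-shape k0 j0 (nmat p q r s) = S⊗ (+ p) (+ q) (+ r) (+ s) refl refl
S-shape k1 j0 (nmat p q r s) = S⊗ (- + r) (- + s) (+ p) (+ q) refl refl
S-shape k2 j0 (nmat p q r s) = S⊗ (- + p) (- + q) (- + r) (- + s) (ℤ.neg-involutive _) (ℤ.neg-involutive _)
S-shape k3 j0 (nmat p q r s) = S⊗ (+ r) (+ s) (- + p) (- + q) (ℤ.neg-involutive _) (ℤ.neg-involutive _)
S-shape k0 j1 (nmat p q r s) = S⊗ (+ q) (- + p) (+ s) (- + r) refl (ℤ.neg-involutive _)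
S-shape k1 j1 (nmat p q r s) = S⊗ (- + s) (+ r) (+ q) (- + p) refl (ℤ.neg-involutive _)
S-shape k2 j1 (nmat p q r s) = S⊗ (- + q) (+ p) (- + s) (+ r) (ℤ.neg-involutive _) refl
S-shape k3 j1 (nmat p q r s) = S⊗ (+ s) (- + r) (- + q) (+ p) (ℤ.neg-involutive _) refl

neg-sum : ∀ (x y : ℤ) → - x + - y ≡ - (x + y)
neg-sum = solve-∀

neg-sum+x : ∀ (x y : ℤ) → - (x + y) + x ≡ - y
neg-sum+x = solve-∀

sum-x : ∀ (x y : ℤ) → (x + y) + - x ≡ y
sum-x = solve-∀

-y+sum : ∀ (x y : ℤ) → - y + (x + y) ≡ x
-y+sum = solve-∀

y-sum : ∀ (x y : ℤ) → y + - (x + y) ≡ - x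
y-sum = solve-∀

-- T commutes with S² = -I, so it acts on Q when k is even.
T-shape₀ : ∀ j Q → Tmat ⊗ shape k0 j Q ≡ shape k0 j (T· Q)
T-shape₀ j0 (nmat p q r s) = T⊗ (+ p) (+ q) (+ r) (+ s) refl refl
T-shape₀ j1 (nmat p q r s) = T⊗ (+ q) (- + p) (+ s) (- + r) refl (neg-sum (+ p) (+ r))

T-shape₂ : ∀ j Q → Tmat ⊗ shape k2 j Q ≡ shape k2 j (T· Q)
T-shape₂ j0 (nmat p q r s) = T⊗ (- + p) (- + q) (- + r) (- + s) (neg-sum (+ p) (+ r)) (neg-sum (+ q) (+ s))
T-shape₂ j1 (nmat p q r s) = T⊗ (- + q) (+ p) (- + s) (+ r) (neg-sum (+ q) (+ s)) refl

-- For odd k: T S L = S (from TSTST = S) and T S T = L.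
T-shape₁L : ∀ j Q → Tmat ⊗ shape k1 j (L· Q) ≡ shape k1 j Q
T-shape₁L j0 (nmat p q r s) = T⊗ (- + (p ℕ.+ r)) (- + (q ℕ.+ s)) (+ p) (+ q) (neg-sum+x (+ p) (+ r)) (neg-sum+x (+ q) (+ s))
T-shape₁L j1 (nmat p q r s) = T⊗ (- + (q ℕ.+ s)) (+ (p ℕ.+ r)) (+ q) (- + p) (neg-sum+x (+ q) (+ s)) (sum-x (+ p) (+ r))

T-shape₁T : ∀ j Q → Tmat ⊗ shape k1 j (T· Q) ≡ shape k0 j (L· Q)
T-shape₁T j0 (nmat p q r s) = T⊗ (- + r) (- + s) (+ (p ℕ.+ r)) (+ (q ℕ.+ s)) (-y+sum (+ p) (+ r)) (-y+sum (+ q) (+ s))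
T-shape₁T j1 (nmat p q r s) = T⊗ (- + s) (+ r) (+ (q ℕ.+ s)) (- + (p ℕ.+ r)) (-y+sum (+ q) (+ s)) (y-sum (+ p) (+ r))

T-shape₃L : ∀ j Q → Tmat ⊗ shape k3 j (L· Q) ≡ shape k3 j Q
T-shape₃L j0 (nmat p q r s) = T⊗ (+ (p ℕ.+ r)) (+ (q ℕ.+ s)) (- + p) (- + q) (sum-x (+ p) (+ r)) (sum-x (+ q) (+ s))
T-shape₃L j1 (nmat p q r s) = T⊗ (+ (q ℕ.+ s)) (- + (p ℕ.+ r)) (- + q) (+ p) (sum-x (+ q) (+ s)) (neg-sum+x (+ p) (+ r))

T-shape₃T : ∀ j Q → Tmat ⊗ shape k3 j (T· Q) ≡ shape k2 j (L· Q)
T-shape₃T j0 (nmat p q r s) = T⊗ (+ r) (+ s) (- + (p ℕ.+ r)) (- + (q ℕ.+ s)) (y-sum (+ p) (+ r)) (y-sum (+ q) (+ s))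
T-shape₃T j1 (nmat p q r s) = T⊗ (+ s) (- + r) (- + (q ℕ.+ s)) (+ (p ℕ.+ r)) (y-sum (+ q) (+ s)) (-y+sum (+ p) (+ r))

Sᵏ : K4 → List Letter
Sᵏ k0 = []
Sᵏ k1 = 𝕊 ∷ []
Sᵏ k2 = 𝕊 ∷ 𝕊 ∷ []
Sᵏ k3 = 𝕊 ∷ 𝕊 ∷ 𝕊 ∷ []

Sʲ : J2 → List Letter
Sʲ j0 = []
Sʲ j1 = 𝕊 ∷ []

⌊_⌋ : List PLetter → List Letter
⌊ [] ⌋ = []
⌊ 𝕋⁺ ∷ w ⌋ = 𝕋 ∷ ⌊ w ⌋
⌊ 𝕃⁺ ∷ w ⌋ = 𝕋 ∷ 𝕊 ∷ 𝕋 ∷ ⌊ w ⌋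

nf-word : K4 → J2 → List PLetter → List Letter
nf-word k j w = Sᵏ k ++ ⌊ w ⌋ ++ Sʲ j

module WellDefined {X : Set} (𝒜 : SL₂Action X) where
  open SL₂Action 𝒜

  private
    then : ∀ {y y′} v → y ≡ y′ → y · v ≡ y′ · v
    then v = cong (_· v)

  S²-central : ∀ x → σS (σS (σS (σT x))) ≡ σS (σT (σS (σS x)))
  S²-central x = cong σS (sym (S²T≈TS² x))

  TS³TST≈S³ : ∀ x → x · (𝕋 ∷ 𝕊 ∷ 𝕊 ∷ 𝕊 ∷ 𝕋 ∷ 𝕊 ∷ 𝕋 ∷ []) ≡ x · (𝕊 ∷ 𝕊 ∷ 𝕊 ∷ [])
  TS³TST≈S³ x = begin
    σT (σS (σT (σS (σS u))))   ≡⟨ cong (σT ∘′ σS) (S²T≈TS² u) ⟩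
    σT (σS (σS (σS (σT u))))   ≡⟨ S²T≈TS² (σS (σT u)) ⟩
    σS (σS (σT (σS (σT u))))   ≡⟨ cong (σS ∘′ σS) (TSTST≈S x) ⟩
    σS (σS (σS x))             ∎
    where
    open ≡-Reasoning
    u = σS (σT x)

  record Moves (m : Mat) (x z : X) : Set where
    constructor via
    field
      k : K4
      j : J2
      w : List PLetter
      is-nf : m ≡ shape k j ⟦ w ⟧₊
      sends : x · nf-word k j w ≡ z

  moves-S : ∀ {m x z} → Moves m (σS x) z → Moves (Smat ⊗ m) x z
  moves-S {x = x} (via k j w refl sends) = via (sucK k) j w (S-shape k j ⟦ w ⟧₊) (trans (step k) sends)
    where
    step : ∀ k → x · nf-word (sucK k) j w ≡ σS x · nf-word k j w
    step k0 = refl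
    step k1 = refl
    step k2 = refl
    step k3 = then (⌊ w ⌋ ++ Sʲ j) (sym (S⁴≈1 x))

  moves-T : ∀ {m x z} → Moves m (σT x) z → Moves (Tmat ⊗ m) x z
  moves-T (via k0 j w refl sends) = via k0 j (𝕋⁺ ∷ w) (T-shape₀ j ⟦ w ⟧₊) sends
  moves-T {x = x} (via k2 j w refl sends) =
    via k2 j (𝕋⁺ ∷ w) (T-shape₂ j ⟦ w ⟧₊) (trans (then (⌊ w ⌋ ++ Sʲ j) (S²T≈TS² x)) sends)
  moves-T {x = x} (via k1 j (𝕃⁺ ∷ w) refl sends) =
    via k1 j w (T-shape₁L j ⟦ w ⟧₊) (trans (then (⌊ w ⌋ ++ Sʲ j) (sym (TSTST≈S x))) sends)
  moves-T (via k1 j (𝕋⁺ ∷ w) refl sends) = via k0 j (𝕃⁺ ∷ w) (T-shape₁T j ⟦ w ⟧₊) sends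
  moves-T (via k1 j0 [] refl sends) = via k0 j1 (𝕋⁺ ∷ []) refl sends
  moves-T {x = x} (via k1 j1 [] refl sends) = via k2 j0 (𝕋⁺ ∷ []) refl (trans (S²T≈TS² x) sends)
  moves-T {x = x} (via k3 j (𝕃⁺ ∷ w) refl sends) =
    via k3 j w (T-shape₃L j ⟦ w ⟧₊) (trans (then (⌊ w ⌋ ++ Sʲ j) (sym (TS³TST≈S³ x))) sends)
  moves-T {x = x} (via k3 j (𝕋⁺ ∷ w) refl sends) =
    via k2 j (𝕃⁺ ∷ w) (T-shape₃T j ⟦ w ⟧₊) (trans (then (⌊ w ⌋ ++ Sʲ j) (sym (cong σT (S²-central x)))) sends)
  moves-T {x = x} (via k3 j0 [] refl sends) = via k2 j1 (𝕋⁺ ∷ []) refl (trans (sym (S²-central x)) sends)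
  moves-T {x = x} (via k3 j1 [] refl sends) = via k0 j0 (𝕋⁺ ∷ []) refl (trans (sym (S⁴≈1 (σT x))) sends)

  moves-word : ∀ u {x} → Moves ⟦ u ⟧ x (x · u)
  moves-word [] = via k0 j0 [] refl refl
  moves-word (𝕊 ∷ u) = moves-S (moves-word u)
  moves-word (𝕋 ∷ u) = moves-T (moves-word u)

  Sᵏ-then-S : ∀ k x → x · nf-word k j1 [] ≡ x · nf-word (sucK k) j0 []
  Sᵏ-then-S k0 x = refl
  Sᵏ-then-S k1 x = refl
  Sᵏ-then-S k2 x = refl
  Sᵏ-then-S k3 x = S⁴≈1 x

  same-power : ∀ {k j k′ j′} → SamePower k j k′ j′ → ∀ x → x · nf-word k j [] ≡ x · nf-word k′ j′ []
  same-power (shift₀₁ {k}) x = sym (Sᵏ-then-S k x)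
  same-power (shift₁₀ {k}) x = Sᵏ-then-S k x

  moves-unique : ∀ {m x z z′} → Moves m x z → Moves m x z′ → z ≡ z′
  moves-unique {x = x} (via k j w refl sends) (via k′ j′ w′ same sends′)
    with shape-injective k j k′ j′ (⟦⟧₊-positive w) (⟦⟧₊-positive w′) same
  ... | inj₁ (refl , refl , Q≡Q′) with ⟦⟧₊-injective w w′ Q≡Q′
  ...   | refl = trans (sym sends) sends′
  moves-unique {x = x} (via k j w refl sends) (via k′ j′ w′ same sends′)
      | inj₂ (power , diag , diag′) with ⟦⟧₊-diagonal w diag | ⟦⟧₊-diagonal w′ diag′
  ...   | refl | refl = trans (sym sends) (trans (same-power power x) sends′)

  ⟦⟧-determines-action : ∀ u v → ⟦ u ⟧ ≡ ⟦ v ⟧ → ∀ x → x · u ≡ x · v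
  ⟦⟧-determines-action u v eq x =
    moves-unique (moves-word u) (subst (λ m → Moves m x (x · v)) (sym eq) (moves-word v))

repeat : ℕ → List Letter → List Letter
repeat zero u = []
repeat (suc n) u = u ++ repeat n u

repeat-+ : ∀ m n u → repeat (m ℕ.+ n) u ≡ repeat m u ++ repeat n u
repeat-+ zero n u = refl
repeat-+ (suc m) n u = trans (cong (u ++_) (repeat-+ m n u)) (sym (++-assoc u (repeat m u) (repeat n u)))

repeat-* : ∀ m n u → repeat (m ℕ.* n) u ≡ repeat m (repeat n u)
repeat-* zero n u = refl
repeat-* (suc m) n u = trans (repeat-+ n (m ℕ.* n) u) (cong (repeat n u ++_) (repeat-* m n u))

power : List Letter → List Letter → ℤ → List Letter
power u u⁻ (+ n) = repeat n u
power u u⁻ -[1+ n ] = repeat (suc n) u⁻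

power-neg : ∀ u u⁻ n → power u u⁻ (- + n) ≡ repeat n u⁻
power-neg u u⁻ zero = refl
power-neg u u⁻ (suc n) = refl

⟦power⟧ : ∀ u u⁻ (P : ℤ → Mat) → P 0 ≡ I →
          (∀ n → ⟦ u ⟧ ⊗ P (+ n) ≡ P (+ suc n)) → (∀ n → ⟦ u⁻ ⟧ ⊗ P (- + n) ≡ P -[1+ n ]) →
          ∀ z → ⟦ power u u⁻ z ⟧ ≡ P z
⟦power⟧ u u⁻ P P0≡I up down = λ where
    (+ n) → ⟦repeat⟧ u (λ n → P (+ n)) P0≡I up n
    -[1+ n ] → ⟦repeat⟧ u⁻ (λ n → P (- + n)) P0≡I down (suc n)
  where
  ⟦repeat⟧ : ∀ v (Q : ℕ → Mat) → Q 0 ≡ I → (∀ n → ⟦ v ⟧ ⊗ Q n ≡ Q (suc n)) → ∀ n → ⟦ repeat n v ⟧ ≡ Q n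
  ⟦repeat⟧ v Q Q0≡I step zero = sym Q0≡I
  ⟦repeat⟧ v Q Q0≡I step (suc n) =
    trans (⟦⟧-++ v (repeat n v)) (trans (cong (⟦ v ⟧ ⊗_) (⟦repeat⟧ v Q Q0≡I step n)) (step n))

T^ L^ : ℤ → Mat
T^ z = mat 1 z 0 1
L^ z = mat 1 0 z 1

T⁻¹-word L-word L⁻¹-word : List Letter
T⁻¹-word = 𝕊 ∷ 𝕋 ∷ 𝕊 ∷ 𝕋 ∷ 𝕊 ∷ 𝕊 ∷ 𝕊 ∷ []
L-word = 𝕋 ∷ 𝕊 ∷ 𝕋 ∷ []
L⁻¹-word = 𝕊 ∷ 𝕊 ∷ 𝕊 ∷ 𝕋 ∷ 𝕊 ∷ []

𝕋^ 𝕃^ : ℤ → List Letter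
𝕋^ = power (𝕋 ∷ []) T⁻¹-word
𝕃^ = power L-word L⁻¹-word

⟦𝕋^⟧ : ∀ z → ⟦ 𝕋^ z ⟧ ≡ T^ z
⟦𝕋^⟧ = ⟦power⟧ (𝕋 ∷ []) T⁻¹-word T^ refl
  (λ n → mat-cong refl (up (+ n)) refl refl)
  (λ n → mat-cong refl (down (+ n)) refl refl)
  where
  up : ∀ (x : ℤ) → 1 * x + 1 * 1 ≡ 1 + x
  up = solve-∀
  down : ∀ (x : ℤ) → 1 * (- x) + -1 * 1 ≡ - (1 + x)
  down = solve-∀

⟦𝕃^⟧ : ∀ z → ⟦ 𝕃^ z ⟧ ≡ L^ z
⟦𝕃^⟧ = ⟦power⟧ L-word L⁻¹-word L^ refl
  (λ n → mat-cong refl refl (up (+ n)) refl)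
  (λ n → mat-cong refl refl (down (+ n)) refl)
  where
  up : ∀ (x : ℤ) → 1 * 1 + 1 * x ≡ 1 + x
  up = solve-∀
  down : ∀ (x : ℤ) → -1 * 1 + 1 * (- x) ≡ - (1 + x)
  down = solve-∀

det-T^ : ∀ z → det (T^ z) ≡ 1
det-T^ z = expand z
  where
  expand : ∀ (z : ℤ) → 1 * 1 - z * 0 ≡ 1
  expand = solve-∀

det-L^ : ∀ z → det (L^ z) ≡ 1
det-L^ z = expand z
  where
  expand : ∀ (z : ℤ) → 1 * 1 - 0 * z ≡ 1
  expand = solve-∀

T^-inverse : ∀ z → T^ (- z) ⊗ T^ z ≡ I
T^-inverse z = mat-cong (one z) (cancel z) refl refl
  where
  one : ∀ (z : ℤ) → 1 * 1 + (- z) * 0 ≡ 1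
  one = solve-∀
  cancel : ∀ (z : ℤ) → 1 * z + (- z) * 1 ≡ 0
  cancel = solve-∀

L^-inverse : ∀ z → L^ (- z) ⊗ L^ z ≡ I
L^-inverse z = mat-cong refl refl (cancel z) (one z)
  where
  cancel : ∀ (z : ℤ) → (- z) * 1 + 1 * z ≡ 0
  cancel = solve-∀
  one : ∀ (z : ℤ) → (- z) * 0 + 1 * 1 ≡ 1
  one = solve-∀

module TrivialPowers {X : Set} (𝒜 : SL₂Action X) where
  open SL₂Action 𝒜
  open WellDefined 𝒜

  repeat-trivial : ∀ {u} → (∀ x → x · u ≡ x) → ∀ n x → x · repeat n u ≡ x
  repeat-trivial triv zero x = refl
  repeat-trivial {u} triv (suc n) x = begin
    x · (u ++ repeat n u) ≡⟨ ·-++ x u (repeat n u) ⟩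
    x · u · repeat n u    ≡⟨ cong (_· repeat n u) (triv x) ⟩
    x · repeat n u        ≡⟨ repeat-trivial triv n x ⟩
    x                     ∎
    where open ≡-Reasoning

  inverse-trivial : ∀ {u v} → ⟦ v ++ u ⟧ ≡ I → (∀ x → x · u ≡ x) → ∀ x → x · v ≡ x
  inverse-trivial {u} {v} vu≡I triv x = begin
    x · v         ≡⟨ sym (triv (x · v)) ⟩
    x · v · u     ≡⟨ sym (·-++ x v u) ⟩
    x · (v ++ u)  ≡⟨ ⟦⟧-determines-action (v ++ u) [] vu≡I x ⟩
    x             ∎
    where open ≡-Reasoning

  power-trivial : ∀ u u⁻ (P : ℤ → Mat) → (∀ z → ⟦ power u u⁻ z ⟧ ≡ P z) → (∀ z → P (- z) ⊗ P z ≡ I) →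
                  ∀ w → (∀ x → x · repeat w u ≡ x) → ∀ {z} → + w ∣ᶻ z → ∀ x → x · power u u⁻ z ≡ x
  power-trivial u u⁻ P ⟦power⟧≡P inverse w triv {z} (dividesᶻ q z≡qw) x =
    multiple q (cong (λ z → x · power u u⁻ z) z≡qw)
    where
    open ≡-Reasoning
    triv⁻ : ∀ x → x · repeat w u⁻ ≡ x
    triv⁻ = inverse-trivial {repeat w u} {repeat w u⁻} (begin
      ⟦ repeat w u⁻ ++ repeat w u ⟧                   ≡⟨ ⟦⟧-++ (repeat w u⁻) (repeat w u) ⟩
      ⟦ repeat w u⁻ ⟧ ⊗ ⟦ repeat w u ⟧                ≡⟨ cong (λ v → ⟦ v ⟧ ⊗ ⟦ repeat w u ⟧) (sym (power-neg u u⁻ w)) ⟩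
      ⟦ power u u⁻ (- + w) ⟧ ⊗ ⟦ power u u⁻ (+ w) ⟧   ≡⟨ cong₂ _⊗_ (⟦power⟧≡P (- + w)) (⟦power⟧≡P (+ w)) ⟩
      P (- + w) ⊗ P (+ w)                            ≡⟨ inverse (+ w) ⟩
      I                                              ∎) triv
    multiple : ∀ q → x · power u u⁻ z ≡ x · power u u⁻ (q * + w) → x · power u u⁻ z ≡ x
    multiple (+ m) eq = begin
      x · power u u⁻ z                 ≡⟨ eq ⟩
      x · power u u⁻ (+ m * + w)       ≡⟨ cong (λ z → x · power u u⁻ z) (sym (ℤ.pos-* m w)) ⟩
      x · repeat (m ℕ.* w) u           ≡⟨ cong (x ·_) (repeat-* m w u) ⟩
      x · repeat m (repeat w u)        ≡⟨ repeat-trivial {repeat w u} triv m x ⟩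
      x                                ∎
    multiple -[1+ m ] eq = begin
      x · power u u⁻ z                        ≡⟨ eq ⟩
      x · power u u⁻ (- + suc m * + w)        ≡⟨ cong (λ z → x · power u u⁻ z) (sym (ℤ.neg-distribˡ-* (+ suc m) (+ w))) ⟩
      x · power u u⁻ (- (+ suc m * + w))      ≡⟨ cong (λ z → x · power u u⁻ (- z)) (sym (ℤ.pos-* (suc m) w)) ⟩
      x · power u u⁻ (- + (suc m ℕ.* w))      ≡⟨ cong (x ·_) (power-neg u u⁻ (suc m ℕ.* w)) ⟩
      x · repeat (suc m ℕ.* w) u⁻             ≡⟨ cong (x ·_) (repeat-* (suc m) w u⁻) ⟩
      x · repeat (suc m) (repeat w u⁻)        ≡⟨ repeat-trivial {repeat w u⁻} triv⁻ (suc m) x ⟩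
      x                                       ∎

coprime-∣ʳ : ∀ {x y z} → Coprime x y → z ∣ y → Coprime x z
coprime-∣ʳ x⊥y z∣y (i∣x , i∣z) = x⊥y (i∣x , ∣-trans i∣z z∣y)

coprime-∣ˡ : ∀ {x y i} → Coprime x y → i ∣ x → Coprime i y
coprime-∣ˡ x⊥y i∣x (j∣i , j∣y) = x⊥y (∣-trans j∣i i∣x , j∣y)

coprime-*ʳ : ∀ {x y z} → Coprime x y → Coprime x z → Coprime x (y ℕ.* z)
coprime-*ʳ x⊥y x⊥z (i∣x , i∣yz) = x⊥z (i∣x , coprime-divisor (coprime-∣ˡ x⊥y i∣x) i∣yz)

coprime-1 : ∀ {x} → Coprime x 1
coprime-1 (_ , i∣1) = ∣1⇒≡1 i∣1

2≤ : ∀ {g} → g ≢ 0 → g ≢ 1 → 2 ℕ.≤ g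
2≤ {zero} g≢0 _ = ⊥-elim (g≢0 refl)
2≤ {suc zero} _ g≢1 = ⊥-elim (g≢1 refl)
2≤ {suc (suc _)} _ _ = ℕ.s≤s (ℕ.s≤s ℕ.z≤n)

-- N = h · t, where h is coprime to c and t is made of primes dividing c.
record CoprimeSplit (c N : ℕ) : Set where
  constructor split
  field
    h t   : ℕ
    N≡h*t : N ≡ h ℕ.* t
    h⊥c   : Coprime h c
    ⊥c⇒⊥t : ∀ {x} → Coprime x c → Coprime x t

-- Split off gcd(N, c) repeatedly (well-founded recursion on N).
coprime-split : ∀ c N → 1 ℕ.≤ N → CoprimeSplit c N
coprime-split c = <-rec (λ N → 1 ℕ.≤ N → CoprimeSplit c N) step
  where
  step : ∀ N → (∀ {M} → M ℕ.< N → 1 ℕ.≤ M → CoprimeSplit c M) → 1 ℕ.≤ N → CoprimeSplit c N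
  step N rec 1≤N with gcd N c ℕ.≟ 1
  ... | yes g≡1 = split N 1 (sym (ℕ.*-identityʳ N)) (gcd≡1⇒coprime g≡1) (λ _ → coprime-1)
  ... | no g≢1 with gcd[m,n]∣m N c
  ...   | divides N₁ N≡N₁g =
    split h (g ℕ.* t) N≡h[gt] h⊥c (λ x⊥c → coprime-*ʳ (coprime-∣ʳ x⊥c (gcd[m,n]∣n N c)) (⊥c⇒⊥t x⊥c))
    where
    g = gcd N c
    N≢0 : N ≢ 0
    N≢0 N≡0 = ℕ.<-irrefl (sym N≡0) 1≤N
    1≤N₁ : 1 ℕ.≤ N₁
    1≤N₁ = ℕ.n≢0⇒n>0 (λ N₁≡0 → N≢0 (trans N≡N₁g (cong (ℕ._* g) N₁≡0)))
    N₁<N : N₁ ℕ.< N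
    N₁<N = subst (N₁ ℕ.<_) (sym N≡N₁g) (ℕ.m<m*n N₁ g {{ℕ.>-nonZero 1≤N₁}} (2≤ (gcd[m,n]≢0 N c (inj₁ N≢0)) g≢1))
    open CoprimeSplit (rec N₁<N 1≤N₁)
    N≡h[gt] : N ≡ h ℕ.* (g ℕ.* t)
    N≡h[gt] = trans N≡N₁g (trans (cong (ℕ._* g) N≡h*t) (trans (ℕ.*-assoc h t g) (cong (h ℕ.*_) (ℕ.*-comm t g))))

coprime-shift : ∀ {a c} N → Coprime c a → 1 ℕ.≤ N → ∃ λ h → Coprime (c ℕ.+ h ℕ.* a) N
coprime-shift {a} {c} N c⊥a 1≤N with coprime-split c N 1≤N
... | split h t N≡h*t h⊥c ⊥c⇒⊥t = h , subst (Coprime v) (sym N≡h*t) (coprime-*ʳ v⊥h (⊥c⇒⊥t v⊥c))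
  where
  v = c ℕ.+ h ℕ.* a
  v⊥h : Coprime v h
  v⊥h {i} (i∣v , i∣h) = h⊥c (i∣h , ∣m+n∣m⇒∣n {m = h ℕ.* a} (subst (i ∣_) (ℕ.+-comm c (h ℕ.* a)) i∣v) (ℕ.∣m⇒∣m*n a i∣h))
  v⊥c : Coprime v c
  v⊥c (i∣v , i∣c) = coprime-*ʳ (Coprimality.sym h⊥c) c⊥a (i∣c , ∣m+n∣m⇒∣n i∣v i∣c)

lift : ∀ {m n k l} → 1 ℕ.+ m ℕ.* n ≡ k ℕ.* l → 1 + + m * + n ≡ + k * + l
lift {m} {n} {k} {l} eq = trans (cong (λ x → 1 + x) (sym (ℤ.pos-* m n))) (trans (cong +_ eq) (ℤ.pos-* k l))

inverse-mod : ∀ {v N} → Coprime v N → ∃ λ Y → + N ∣ᶻ 1 - Y * + v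
inverse-mod {v} {N} v⊥N with Coprimality.coprime-Bézout v⊥N
... | Bézout.+- x y 1+yN≡xv = + x , dividesᶻ (- + y) (begin
      1 - + x * + v             ≡⟨ cong (λ x → 1 - x) (sym (lift {y} {N} {x} {v} 1+yN≡xv)) ⟩
      1 - (1 + + y * + N)       ≡⟨ cancel (+ y) (+ N) ⟩
      - + y * + N               ∎)
  where
  open ≡-Reasoning
  cancel : ∀ (y N : ℤ) → 1 - (1 + y * N) ≡ - y * N
  cancel = solve-∀
... | Bézout.-+ x y 1+xv≡yN = - + x , dividesᶻ (+ y) (begin
      1 - - + x * + v           ≡⟨ plus (+ x) (+ v) ⟩
      1 + + x * + v             ≡⟨ lift {x} {v} {y} {N} 1+xv≡yN ⟩
      + y * + N                 ∎)
  where
  open ≡-Reasoning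
  plus : ∀ (x v : ℤ) → 1 - - x * v ≡ 1 + x * v
  plus = solve-∀

-- The last entry is forced by the other three and the determinant.
to-congruence : ∀ N m → det m ≡ 1 → + N ∣ᶻ a m - 1 → + N ∣ᶻ b m → + N ∣ᶻ c m → PrincipalCongruence N m
to-congruence N (mat p q r s) det≡1 N∣p-1 N∣q N∣r = det≡1 , ∣⇒∣ᵤ N∣p-1 , ∣⇒∣ᵤ N∣q , ∣⇒∣ᵤ N∣r , ∣⇒∣ᵤ N∣s-1
  where
  expand : ∀ (p q r s : ℤ) → (- s) * (p - 1) + r * q ≡ s - (p * s - q * r)
  expand = solve-∀
  N∣s-1 : + N ∣ᶻ s - 1
  N∣s-1 = subst (+ N ∣ᶻ_) (trans (expand p q r s) (cong (λ x → s - x) det≡1))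
            (∣m∣n⇒∣m+n (∣n⇒∣m*n (- s) N∣p-1) (∣n⇒∣m*n r N∣q))

clear-off-diagonal : ∀ N M → det M ≡ 1 → + N ∣ᶻ a M - 1 → PrincipalCongruence N (L^ (- c M) ⊗ (M ⊗ T^ (- b M)))
clear-off-diagonal N (mat p q r s) det≡1 N∣p-1 =
  to-congruence N (L^ (- r) ⊗ (mat p q r s ⊗ T^ (- q)))
    (trans (det-⊗ (L^ (- r)) (mat p q r s ⊗ T^ (- q)))
           (cong₂ _*_ (det-L^ (- r)) (trans (det-⊗ (mat p q r s) (T^ (- q))) (cong₂ _*_ det≡1 (det-T^ (- q))))))
    (subst (λ x → + N ∣ᶻ x - 1) (sym (top-left p q r s)) N∣p-1)
    (subst (+ N ∣ᶻ_) (sym (top-right p q r s)) (∣n⇒∣m*n (- q) N∣p-1))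
    (subst (+ N ∣ᶻ_) (sym (bottom-left p q r s)) (∣n⇒∣m*n (- r) N∣p-1))
  where
  top-left : ∀ (p q r s : ℤ) → 1 * (p * 1 + q * 0) + 0 * (r * 1 + s * 0) ≡ p
  top-left = solve-∀
  top-right : ∀ (p q r s : ℤ) → 1 * (p * (- q) + q * 1) + 0 * (r * (- q) + s * 1) ≡ - q * (p - 1)
  top-right = solve-∀
  bottom-left : ∀ (p q r s : ℤ) → (- r) * (p * 1 + q * 0) + 1 * (r * 1 + s * 0) ≡ - r * (p - 1)
  bottom-left = solve-∀

conjugate : ∀ h z A B C D →
            L^ (- h) ⊗ (T^ z ⊗ (L^ h ⊗ mat A B C D)) ≡
            mat (A + z * (C + h * A)) (B + z * (D + h * B)) (C - h * (z * (C + h * A))) (D - h * (z * (D + h * B)))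
conjugate h z A B C D = mat-cong (top h z A C) (top h z B D) (bottom h z A C) (bottom h z B D)
  where
  top : ∀ (h z A C : ℤ) →
        1 * (1 * (1 * A + 0 * C) + z * (h * A + 1 * C)) + 0 * (0 * (1 * A + 0 * C) + 1 * (h * A + 1 * C)) ≡
        A + z * (C + h * A)
  top = solve-∀
  bottom : ∀ (h z A C : ℤ) →
           (- h) * (1 * (1 * A + 0 * C) + z * (h * A + 1 * C)) + 1 * (0 * (1 * A + 0 * C) + 1 * (h * A + 1 * C)) ≡
           C - h * (z * (C + h * A))
  bottom = solve-∀

module Criterion {X : Set} (𝒜 : SL₂Action X) where
  open SL₂Action 𝒜
  open WellDefined 𝒜
  open TrivialPowers 𝒜

  Fixes : X → Mat → Set
  Fixes x₀ g = Σ (List Letter) λ u → ⟦ u ⟧ ≡ g × x₀ · u ≡ x₀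

  fixes-⊗ : ∀ {x₀ g m} → Fixes x₀ g → Fixes x₀ m → Fixes x₀ (g ⊗ m)
  fixes-⊗ {x₀} (u , ⟦u⟧≡g , x₀u≡x₀) (v , ⟦v⟧≡m , x₀v≡x₀) =
    u ++ v , trans (⟦⟧-++ u v) (cong₂ _⊗_ ⟦u⟧≡g ⟦v⟧≡m) , trans (·-++ x₀ u v) (trans (cong (_· v) x₀u≡x₀) x₀v≡x₀)

  ⟨⟩-fixes : ∀ {x₀ gs} → (∀ {g} → g ∈ gs → Fixes x₀ g × Fixes x₀ (inv g)) → ∀ {m} → ⟨ gs ⟩ m → Fixes x₀ m
  ⟨⟩-fixes gens gen-id = [] , refl , refl
  ⟨⟩-fixes gens (gen-mul g∈gs m∈Γ) = fixes-⊗ (proj₁ (gens g∈gs)) (⟨⟩-fixes gens m∈Γ)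
  ⟨⟩-fixes gens (gen-inv g∈gs m∈Γ) = fixes-⊗ (proj₂ (gens g∈gs)) (⟨⟩-fixes gens m∈Γ)

  fixes-word : ∀ {x₀ m} → Fixes x₀ m → ∀ u → ⟦ u ⟧ ≡ m → x₀ · u ≡ x₀
  fixes-word {x₀} (v , ⟦v⟧≡m , x₀v≡x₀) u ⟦u⟧≡m = trans (⟦⟧-determines-action u v (trans ⟦u⟧≡m (sym ⟦v⟧≡m)) x₀) x₀v≡x₀

  record MovingElement (x₀ : X) (w : ℕ) : Set where
    field
      α γ   : ℕ
      β δ   : ℤ
      e     : List Letter
      ⟦e⟧   : ⟦ e ⟧ ≡ mat (+ α) β (+ γ) δ
      w∣α-1 : + w ∣ᶻ + α - 1
      w∣β   : + w ∣ᶻ β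
      w∣γ   : + w ∣ᶻ + γ
      γ⊥α   : Coprime γ α
      moves : ¬ (x₀ · e ≡ x₀)

  -- For a fixed N ≥ 1: a word u acting like e with ⟦ u ⟧ ∈ Γ(N).
  module Construction (x₀ : X) (w : ℕ)
    (Tʷ-trivial : ∀ x → x · repeat w (𝕋 ∷ []) ≡ x)
    (Lʷ-trivial : ∀ x → x · repeat w L-word ≡ x)
    (E : MovingElement x₀ w) (N : ℕ) (1≤N : 1 ℕ.≤ N) where
    open MovingElement E
    open ≡-Reasoning

    𝕋^-trivial : ∀ {z} → + w ∣ᶻ z → ∀ x → x · 𝕋^ z ≡ x
    𝕋^-trivial = power-trivial (𝕋 ∷ []) T⁻¹-word T^ ⟦𝕋^⟧ T^-inverse w Tʷ-trivial

    𝕃^-trivial : ∀ {z} → + w ∣ᶻ z → ∀ x → x · 𝕃^ z ≡ x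
    𝕃^-trivial = power-trivial L-word L⁻¹-word L^ ⟦𝕃^⟧ L^-inverse w Lʷ-trivial

    -- h with V = γ + h α a unit mod N, Y its inverse, and z = -(qY)·w where α - 1 = q w.
    h : ℕ
    h = proj₁ (coprime-shift N γ⊥α 1≤N)

    V : ℤ
    V = + γ + + h * + α

    Y : ℤ
    Y = proj₁ (inverse-mod (proj₂ (coprime-shift N γ⊥α 1≤N)))

    N∣1-YV : + N ∣ᶻ 1 - Y * V
    N∣1-YV = subst (λ v → + N ∣ᶻ 1 - Y * v) (cong (λ x → + γ + x) (ℤ.pos-* h α))
               (proj₂ (inverse-mod (proj₂ (coprime-shift N γ⊥α 1≤N))))

    q : ℤ
    q = quotient w∣α-1

    z : ℤ
    z = - (q * Y) * + w

    w∣z : + w ∣ᶻ z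
    w∣z = dividesᶻ (- (q * Y)) refl

    conj : List Letter
    conj = 𝕃^ (- + h) ++ 𝕋^ z ++ 𝕃^ (+ h) ++ e

    M : Mat
    M = ⟦ conj ⟧

    M≡ : M ≡ mat (+ α + z * V) (β + z * (δ + + h * β)) (+ γ - + h * (z * V)) (δ - + h * (z * (δ + + h * β)))
    M≡ = begin
      ⟦ 𝕃^ (- + h) ++ 𝕋^ z ++ 𝕃^ (+ h) ++ e ⟧                ≡⟨ ⟦⟧-++ (𝕃^ (- + h)) _ ⟩
      ⟦ 𝕃^ (- + h) ⟧ ⊗ ⟦ 𝕋^ z ++ 𝕃^ (+ h) ++ e ⟧              ≡⟨ cong (⟦ 𝕃^ (- + h) ⟧ ⊗_) (⟦⟧-++ (𝕋^ z) _) ⟩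
      ⟦ 𝕃^ (- + h) ⟧ ⊗ (⟦ 𝕋^ z ⟧ ⊗ ⟦ 𝕃^ (+ h) ++ e ⟧)        ≡⟨ cong (λ m → ⟦ 𝕃^ (- + h) ⟧ ⊗ (⟦ 𝕋^ z ⟧ ⊗ m))
                                                                  (⟦⟧-++ (𝕃^ (+ h)) e) ⟩
      ⟦ 𝕃^ (- + h) ⟧ ⊗ (⟦ 𝕋^ z ⟧ ⊗ (⟦ 𝕃^ (+ h) ⟧ ⊗ ⟦ e ⟧))    ≡⟨ cong₂ _⊗_ (⟦𝕃^⟧ (- + h))
                                                                  (cong₂ _⊗_ (⟦𝕋^⟧ z) (cong₂ _⊗_ (⟦𝕃^⟧ (+ h)) ⟦e⟧)) ⟩
      L^ (- + h) ⊗ (T^ z ⊗ (L^ (+ h) ⊗ mat (+ α) β (+ γ) δ)) ≡⟨ conjugate (+ h) z (+ α) β (+ γ) δ ⟩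
      _                                                     ∎

    -- M₁₁ - 1 = q w (1 - Y V) ≡ 0 (mod N).
    N∣a[M]-1 : + N ∣ᶻ a M - 1
    N∣a[M]-1 = subst (+ N ∣ᶻ_) (sym (begin
      a M - 1                          ≡⟨ cong (λ m → a m - 1) M≡ ⟩
      (+ α + z * V) - 1                ≡⟨ shift (+ α) z V ⟩
      (+ α - 1) + z * V                ≡⟨ cong (λ x → x + z * V) (_∣ᶻ_.equality w∣α-1) ⟩
      q * + w + - (q * Y) * + w * V    ≡⟨ factor q Y (+ w) V ⟩
      (q * + w) * (1 - Y * V)          ∎)) (∣n⇒∣m*n (q * + w) N∣1-YV)
      where
      shift : ∀ (A z V : ℤ) → (A + z * V) - 1 ≡ (A - 1) + z * V
      shift = solve-∀
      factor : ∀ (q Y W V : ℤ) → q * W + - (q * Y) * W * V ≡ (q * W) * (1 - Y * V)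
      factor = solve-∀

    w∣b[M] : + w ∣ᶻ b M
    w∣b[M] = subst (+ w ∣ᶻ_) (sym (cong b M≡)) (∣m∣n⇒∣m+n w∣β (∣m⇒∣m*n _ w∣z))

    w∣c[M] : + w ∣ᶻ c M
    w∣c[M] = subst (+ w ∣ᶻ_) (sym (cong c M≡)) (∣m∣n⇒∣m-n w∣γ (∣n⇒∣m*n (+ h) (∣m⇒∣m*n V w∣z)))

    u : List Letter
    u = 𝕃^ (- c M) ++ conj ++ 𝕋^ (- b M)

    u-principal : PrincipalCongruence N ⟦ u ⟧
    u-principal = subst (PrincipalCongruence N) (sym ⟦u⟧≡) (clear-off-diagonal N M (det-⟦⟧ conj) N∣a[M]-1)
      where
      ⟦u⟧≡ : ⟦ u ⟧ ≡ L^ (- c M) ⊗ (M ⊗ T^ (- b M))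
      ⟦u⟧≡ = trans (⟦⟧-++ (𝕃^ (- c M)) _)
               (cong₂ _⊗_ (⟦𝕃^⟧ (- c M)) (trans (⟦⟧-++ conj _) (cong (M ⊗_) (⟦𝕋^⟧ (- b M)))))

    conj-acts-as-e : ∀ x → x · conj ≡ x · e
    conj-acts-as-e x = begin
      x · (𝕃^ (- + h) ++ 𝕋^ z ++ 𝕃^ (+ h) ++ e)      ≡⟨ ·-++ x (𝕃^ (- + h)) _ ⟩
      x · 𝕃^ (- + h) · (𝕋^ z ++ 𝕃^ (+ h) ++ e)      ≡⟨ ·-++ _ (𝕋^ z) _ ⟩
      x · 𝕃^ (- + h) · 𝕋^ z · (𝕃^ (+ h) ++ e)        ≡⟨ cong (_· (𝕃^ (+ h) ++ e)) (𝕋^-trivial w∣z _) ⟩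
      x · 𝕃^ (- + h) · (𝕃^ (+ h) ++ e)              ≡⟨ sym (·-++ x (𝕃^ (- + h)) _) ⟩
      x · (𝕃^ (- + h) ++ 𝕃^ (+ h) ++ e)             ≡⟨ cong (x ·_) (sym (++-assoc (𝕃^ (- + h)) (𝕃^ (+ h)) e)) ⟩
      x · ((𝕃^ (- + h) ++ 𝕃^ (+ h)) ++ e)           ≡⟨ ·-++ x (𝕃^ (- + h) ++ 𝕃^ (+ h)) e ⟩
      x · (𝕃^ (- + h) ++ 𝕃^ (+ h)) · e             ≡⟨ cong (_· e) (⟦⟧-determines-action _ [] L-cancel x) ⟩
      x · e                                        ∎
      where
      L-cancel : ⟦ 𝕃^ (- + h) ++ 𝕃^ (+ h) ⟧ ≡ I
      L-cancel = trans (⟦⟧-++ (𝕃^ (- + h)) _) (trans (cong₂ _⊗_ (⟦𝕃^⟧ (- + h)) (⟦𝕃^⟧ (+ h))) (L^-inverse (+ h)))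

    u-acts-as-e : x₀ · u ≡ x₀ · e
    u-acts-as-e = begin
      x₀ · (𝕃^ (- c M) ++ conj ++ 𝕋^ (- b M))  ≡⟨ ·-++ x₀ (𝕃^ (- c M)) _ ⟩
      x₀ · 𝕃^ (- c M) · (conj ++ 𝕋^ (- b M))   ≡⟨ cong (_· (conj ++ 𝕋^ (- b M))) (𝕃^-trivial (∣m⇒∣-m w∣c[M]) x₀) ⟩
      x₀ · (conj ++ 𝕋^ (- b M))                ≡⟨ ·-++ x₀ conj _ ⟩
      x₀ · conj · 𝕋^ (- b M)                   ≡⟨ 𝕋^-trivial (∣m⇒∣-m w∣b[M]) _ ⟩
      x₀ · conj                                ≡⟨ conj-acts-as-e x₀ ⟩
      x₀ · e                                   ∎

  noncongruence-criterion : ∀ {x₀ gs} w → (∀ x → x · repeat w (𝕋 ∷ []) ≡ x) → (∀ x → x · repeat w L-word ≡ x) →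
                            (∀ {g} → g ∈ gs → Fixes x₀ g × Fixes x₀ (inv g)) → MovingElement x₀ w →
                            Noncongruence gs
  noncongruence-criterion {x₀} w Tʷ-trivial Lʷ-trivial gens E N 1≤N Γ[N]⊆Γ = moves (begin
      x₀ · e  ≡⟨ sym u-acts-as-e ⟩
      x₀ · u  ≡⟨ fixes-word (⟨⟩-fixes gens (Γ[N]⊆Γ ⟦ u ⟧ u-principal)) u refl ⟩
      x₀      ∎)
    where
    open MovingElement E
    open Construction x₀ w Tʷ-trivial Lʷ-trivial E N 1≤N
    open ≡-Reasoning

-- A word for a matrix of determinant 1 by the Euclidean algorithm on the first
-- column (M = T^q · S · M′); its correctness is checked afterwards, so the fuel
-- only has to suffice.
euclid : ℕ → Mat → List Letter
euclid _ (mat (+ 1) y (+ 0) _) = 𝕋^ y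
euclid _ (mat _ y (+ 0) _) = 𝕊 ∷ 𝕊 ∷ 𝕋^ (- y)
euclid zero _ = []
euclid (suc n) (mat x y r@(+ suc _) t) = 𝕋^ (x / r) ++ 𝕊 ∷ euclid n (mat r t (- (x - (x / r) * r)) (- (y - (x / r) * t)))
euclid (suc n) (mat x y r@(-[1+ _ ]) t) = 𝕋^ (x / r) ++ 𝕊 ∷ euclid n (mat r t (- (x - (x / r) * r)) (- (y - (x / r) * t)))

word-for : Mat → List Letter
word-for m = euclid (suc ℤ.∣ c m ∣) m

_≟ᴹ_ : DecidableEquality Mat
mat x y z t ≟ᴹ mat x′ y′ z′ t′ =
  map′ (λ { (refl , refl , refl , refl) → refl }) (λ { refl → refl , refl , refl , refl })
       (x ℤ.≟ x′ ×-dec y ℤ.≟ y′ ×-dec z ℤ.≟ z′ ×-dec t ℤ.≟ t′)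

record Certificate : Set where
  field
    n               : ℕ
    S-table T-table : Vec (Fin n) n
    base            : Fin n
    level           : ℕ
    α γ             : ℕ
    β δ             : ℤ

  E : Mat
  E = mat (+ α) β (+ γ) δ

  infixl 5 _·_
  _·_ : Fin n → List Letter → Fin n
  x · u = act (lookup S-table) (lookup T-table) u x

  fixes : Mat → Set
  fixes g = ⟦ word-for g ⟧ ≡ g × base · word-for g ≡ base

  fixes? : ∀ g → Dec (fixes g)
  fixes? g = (⟦ word-for g ⟧ ≟ᴹ g) ×-dec (base · word-for g Fin.≟ base)

  Relation : List Letter → List Letter → Set
  Relation u v = ∀ x → x · u ≡ x · v

  relation? : ∀ u v → Dec (Relation u v)
  relation? u v = Fin.all? λ x → x · u Fin.≟ x · v

  Valid : List Mat → Set
  Valid gs =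
    Relation (𝕊 ∷ 𝕊 ∷ 𝕊 ∷ 𝕊 ∷ []) [] × Relation (𝕊 ∷ 𝕊 ∷ 𝕋 ∷ []) (𝕋 ∷ 𝕊 ∷ 𝕊 ∷ []) ×
    Relation (𝕋 ∷ 𝕊 ∷ 𝕋 ∷ 𝕊 ∷ 𝕋 ∷ []) (𝕊 ∷ []) ×
    Relation (repeat level (𝕋 ∷ [])) [] × Relation (repeat level L-word) [] ×
    All (λ g → fixes g × fixes (inv g)) gs ×
    ⟦ word-for E ⟧ ≡ E × + level ∣ᶻ + α - 1 × + level ∣ᶻ β × + level ∣ᶻ + γ × Coprime γ α ×
    ¬ (base · word-for E ≡ base)

  valid? : ∀ gs → Dec (Valid gs)
  valid? gs =
    relation? (𝕊 ∷ 𝕊 ∷ 𝕊 ∷ 𝕊 ∷ []) [] ×-dec relation? (𝕊 ∷ 𝕊 ∷ 𝕋 ∷ []) (𝕋 ∷ 𝕊 ∷ 𝕊 ∷ []) ×-dec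
    relation? (𝕋 ∷ 𝕊 ∷ 𝕋 ∷ 𝕊 ∷ 𝕋 ∷ []) (𝕊 ∷ []) ×-dec
    relation? (repeat level (𝕋 ∷ [])) [] ×-dec relation? (repeat level L-word) [] ×-dec
    All.all? (λ g → fixes? g ×-dec fixes? (inv g)) gs ×-dec
    (⟦ word-for E ⟧ ≟ᴹ E) ×-dec (+ level ∣ᶻ? + α - 1) ×-dec (+ level ∣ᶻ? β) ×-dec (+ level ∣ᶻ? + γ) ×-dec
    coprime? γ α ×-dec ¬? (base · word-for E Fin.≟ base)

  sound : ∀ gs → Valid gs → Noncongruence gs
  sound gs (S⁴ , S²T , TSTST , Tʷ , Lʷ , gens , ⟦e⟧ , w∣α-1 , w∣β , w∣γ , γ⊥α , moves) =
    noncongruence-criterion level Tʷ Lʷ (λ g∈gs → fixing (proj₁ (All.lookup gens g∈gs)) , fixing (proj₂ (All.lookup gens g∈gs)))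
      (record { α = α ; γ = γ ; β = β ; δ = δ ; e = word-for E ; ⟦e⟧ = ⟦e⟧
              ; w∣α-1 = w∣α-1 ; w∣β = w∣β ; w∣γ = w∣γ ; γ⊥α = γ⊥α ; moves = moves })
    where
    𝒜 : SL₂Action (Fin n)
    𝒜 = record { σS = lookup S-table ; σT = lookup T-table ; S⁴≈1 = S⁴ ; S²T≈TS² = S²T ; TSTST≈S = TSTST }
    open Criterion 𝒜
    fixing : ∀ {g} → fixes g → Fixes base g
    fixing {g} (⟦u⟧≡g , fixed) = word-for g , ⟦u⟧≡g , fixed

certified : ∀ C {gs} {_ : True (Certificate.valid? C gs)} → Noncongruence gs
certified C {gs} {ok} = Certificate.sound C gs (toWitness ok)

certificate₁ : Certificate
certificate₁ = record
  { n = 72 ; base = 0 ; level = 24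
  ; α = 25 ; β = -1008 ; γ = 72 ; δ = -2903
  ; S-table =
      (1 ∷ 59 ∷ 60 ∷ 4 ∷ 43 ∷ 13 ∷ 7 ∷ 15 ∷ 12 ∷ 10 ∷ 11 ∷ 64 ∷ 63 ∷ 14 ∷ 51 ∷ 23 ∷ 17 ∷ 24 ∷ 22 ∷ 20 ∷ 21 ∷ 67 ∷ 65 ∷ 6 ∷
       32 ∷ 26 ∷ 33 ∷ 31 ∷ 29 ∷ 30 ∷ 69 ∷ 58 ∷ 16 ∷ 41 ∷ 35 ∷ 42 ∷ 40 ∷ 38 ∷ 39 ∷ 70 ∷ 57 ∷ 25 ∷ 49 ∷ 50 ∷ 48 ∷ 46 ∷ 47 ∷ 71 ∷
       56 ∷ 34 ∷ 3 ∷ 5 ∷ 2 ∷ 0 ∷ 18 ∷ 8 ∷ 62 ∷ 68 ∷ 66 ∷ 53 ∷ 61 ∷ 52 ∷ 44 ∷ 55 ∷ 9 ∷ 54 ∷ 27 ∷ 19 ∷ 36 ∷ 28 ∷ 37 ∷ 45 ∷ [])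
  ; T-table =
      (0 ∷ 2 ∷ 3 ∷ 56 ∷ 5 ∷ 6 ∷ 24 ∷ 8 ∷ 9 ∷ 55 ∷ 10 ∷ 12 ∷ 13 ∷ 60 ∷ 15 ∷ 16 ∷ 33 ∷ 18 ∷ 19 ∷ 54 ∷ 20 ∷ 22 ∷ 23 ∷ 63 ∷
       25 ∷ 42 ∷ 27 ∷ 28 ∷ 66 ∷ 29 ∷ 31 ∷ 32 ∷ 65 ∷ 34 ∷ 50 ∷ 36 ∷ 37 ∷ 68 ∷ 38 ∷ 40 ∷ 41 ∷ 58 ∷ 4 ∷ 44 ∷ 45 ∷ 62 ∷ 46 ∷ 48 ∷
       49 ∷ 57 ∷ 14 ∷ 52 ∷ 53 ∷ 61 ∷ 7 ∷ 51 ∷ 47 ∷ 39 ∷ 30 ∷ 59 ∷ 1 ∷ 43 ∷ 35 ∷ 11 ∷ 64 ∷ 21 ∷ 17 ∷ 67 ∷ 26 ∷ 69 ∷ 70 ∷ 71 ∷ [])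
  }

certificate₂ : Certificate
certificate₂ = record
  { n = 72 ; base = 0 ; level = 24
  ; α = 25 ; β = -1008 ; γ = 72 ; δ = -2903
  ; S-table =
      (3 ∷ 27 ∷ 45 ∷ 61 ∷ 63 ∷ 6 ∷ 8 ∷ 37 ∷ 39 ∷ 36 ∷ 11 ∷ 53 ∷ 35 ∷ 14 ∷ 70 ∷ 58 ∷ 17 ∷ 19 ∷ 47 ∷ 49 ∷ 46 ∷ 1 ∷ 23 ∷ 9 ∷
       7 ∷ 4 ∷ 2 ∷ 62 ∷ 65 ∷ 30 ∷ 32 ∷ 55 ∷ 57 ∷ 54 ∷ 13 ∷ 69 ∷ 22 ∷ 38 ∷ 24 ∷ 5 ∷ 41 ∷ 33 ∷ 31 ∷ 28 ∷ 0 ∷ 64 ∷ 66 ∷ 48 ∷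
       50 ∷ 16 ∷ 18 ∷ 15 ∷ 12 ∷ 68 ∷ 40 ∷ 56 ∷ 42 ∷ 29 ∷ 59 ∷ 51 ∷ 43 ∷ 44 ∷ 21 ∷ 67 ∷ 26 ∷ 60 ∷ 71 ∷ 25 ∷ 10 ∷ 52 ∷ 34 ∷ 20 ∷ [])
  ; T-table =
      (1 ∷ 2 ∷ 0 ∷ 4 ∷ 5 ∷ 22 ∷ 7 ∷ 6 ∷ 9 ∷ 10 ∷ 41 ∷ 12 ∷ 13 ∷ 11 ∷ 15 ∷ 16 ∷ 66 ∷ 18 ∷ 17 ∷ 20 ∷ 21 ∷ 60 ∷ 53 ∷ 24 ∷
       25 ∷ 26 ∷ 71 ∷ 28 ∷ 29 ∷ 40 ∷ 31 ∷ 30 ∷ 33 ∷ 34 ∷ 59 ∷ 36 ∷ 37 ∷ 63 ∷ 39 ∷ 38 ∷ 14 ∷ 42 ∷ 43 ∷ 44 ∷ 67 ∷ 46 ∷ 47 ∷ 58 ∷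
       49 ∷ 48 ∷ 51 ∷ 52 ∷ 23 ∷ 54 ∷ 55 ∷ 65 ∷ 57 ∷ 56 ∷ 35 ∷ 19 ∷ 32 ∷ 62 ∷ 64 ∷ 45 ∷ 61 ∷ 3 ∷ 27 ∷ 8 ∷ 69 ∷ 70 ∷ 68 ∷ 50 ∷ [])
  }

certificate₃ : Certificate
certificate₃ = record
  { n = 72 ; base = 0 ; level = 24
  ; α = 25 ; β = -1104 ; γ = 144 ; δ = -6359
  ; S-table =
      (1 ∷ 2 ∷ 3 ∷ 0 ∷ 13 ∷ 6 ∷ 15 ∷ 12 ∷ 51 ∷ 29 ∷ 63 ∷ 18 ∷ 38 ∷ 14 ∷ 61 ∷ 37 ∷ 17 ∷ 62 ∷ 32 ∷ 65 ∷ 67 ∷ 19 ∷ 10 ∷ 24 ∷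
       66 ∷ 55 ∷ 27 ∷ 42 ∷ 54 ∷ 30 ∷ 47 ∷ 22 ∷ 33 ∷ 11 ∷ 21 ∷ 36 ∷ 20 ∷ 5 ∷ 57 ∷ 40 ∷ 8 ∷ 56 ∷ 69 ∷ 23 ∷ 45 ∷ 25 ∷ 16 ∷ 9 ∷
       70 ∷ 71 ∷ 48 ∷ 39 ∷ 53 ∷ 41 ∷ 68 ∷ 44 ∷ 52 ∷ 7 ∷ 50 ∷ 60 ∷ 49 ∷ 4 ∷ 46 ∷ 31 ∷ 28 ∷ 34 ∷ 43 ∷ 35 ∷ 64 ∷ 26 ∷ 58 ∷ 59 ∷ [])
  ; T-table =
      (0 ∷ 14 ∷ 2 ∷ 4 ∷ 5 ∷ 62 ∷ 7 ∷ 8 ∷ 9 ∷ 10 ∷ 11 ∷ 6 ∷ 13 ∷ 3 ∷ 15 ∷ 16 ∷ 23 ∷ 18 ∷ 19 ∷ 20 ∷ 21 ∷ 22 ∷ 54 ∷ 56 ∷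
       25 ∷ 26 ∷ 24 ∷ 28 ∷ 29 ∷ 58 ∷ 31 ∷ 32 ∷ 37 ∷ 34 ∷ 35 ∷ 65 ∷ 36 ∷ 38 ∷ 39 ∷ 30 ∷ 41 ∷ 27 ∷ 43 ∷ 44 ∷ 42 ∷ 46 ∷ 33 ∷ 48 ∷
       49 ∷ 50 ∷ 51 ∷ 52 ∷ 69 ∷ 12 ∷ 55 ∷ 17 ∷ 57 ∷ 61 ∷ 59 ∷ 70 ∷ 60 ∷ 1 ∷ 66 ∷ 64 ∷ 45 ∷ 63 ∷ 53 ∷ 67 ∷ 47 ∷ 68 ∷ 40 ∷ 71 ∷ [])
  }

certificate₄ : Certificate
certificate₄ = record
  { n = 72 ; base = 0 ; level = 24
  ; α = 25 ; β = -1008 ; γ = 72 ; δ = -2903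
  ; S-table =
      (1 ∷ 61 ∷ 62 ∷ 4 ∷ 6 ∷ 48 ∷ 50 ∷ 47 ∷ 9 ∷ 29 ∷ 46 ∷ 12 ∷ 68 ∷ 54 ∷ 15 ∷ 17 ∷ 23 ∷ 25 ∷ 22 ∷ 20 ∷ 21 ∷ 70 ∷ 69 ∷ 24 ∷
       26 ∷ 14 ∷ 16 ∷ 13 ∷ 10 ∷ 64 ∷ 67 ∷ 32 ∷ 34 ∷ 40 ∷ 42 ∷ 39 ∷ 37 ∷ 38 ∷ 71 ∷ 59 ∷ 41 ∷ 43 ∷ 31 ∷ 33 ∷ 30 ∷ 11 ∷ 66 ∷ 58 ∷
       49 ∷ 51 ∷ 3 ∷ 5 ∷ 2 ∷ 0 ∷ 55 ∷ 27 ∷ 18 ∷ 7 ∷ 57 ∷ 60 ∷ 35 ∷ 53 ∷ 63 ∷ 52 ∷ 8 ∷ 44 ∷ 28 ∷ 65 ∷ 45 ∷ 56 ∷ 19 ∷ 36 ∷ [])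
  ; T-table =
      (0 ∷ 2 ∷ 3 ∷ 58 ∷ 5 ∷ 4 ∷ 7 ∷ 8 ∷ 65 ∷ 10 ∷ 11 ∷ 9 ∷ 13 ∷ 14 ∷ 69 ∷ 16 ∷ 15 ∷ 18 ∷ 19 ∷ 56 ∷ 20 ∷ 22 ∷ 23 ∷ 54 ∷
       25 ∷ 24 ∷ 27 ∷ 28 ∷ 57 ∷ 30 ∷ 31 ∷ 59 ∷ 33 ∷ 32 ∷ 35 ∷ 36 ∷ 60 ∷ 37 ∷ 39 ∷ 40 ∷ 67 ∷ 42 ∷ 41 ∷ 44 ∷ 45 ∷ 55 ∷ 47 ∷ 48 ∷
       62 ∷ 50 ∷ 49 ∷ 52 ∷ 53 ∷ 63 ∷ 46 ∷ 17 ∷ 26 ∷ 51 ∷ 29 ∷ 38 ∷ 43 ∷ 61 ∷ 1 ∷ 6 ∷ 66 ∷ 34 ∷ 68 ∷ 12 ∷ 64 ∷ 21 ∷ 70 ∷ 71 ∷ [])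
  }

certificate₅ : Certificate
certificate₅ = record
  { n = 72 ; base = 0 ; level = 18
  ; α = 19 ; β = -774 ; γ = 72 ; δ = -2933
  ; S-table =
      (1 ∷ 60 ∷ 61 ∷ 4 ∷ 63 ∷ 65 ∷ 7 ∷ 39 ∷ 45 ∷ 10 ∷ 47 ∷ 19 ∷ 13 ∷ 21 ∷ 18 ∷ 16 ∷ 17 ∷ 69 ∷ 68 ∷ 20 ∷ 51 ∷ 67 ∷ 9 ∷ 66 ∷
       25 ∷ 70 ∷ 34 ∷ 28 ∷ 36 ∷ 33 ∷ 31 ∷ 32 ∷ 71 ∷ 57 ∷ 35 ∷ 59 ∷ 56 ∷ 24 ∷ 53 ∷ 55 ∷ 3 ∷ 42 ∷ 5 ∷ 2 ∷ 0 ∷ 46 ∷ 52 ∷ 22 ∷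
       49 ∷ 23 ∷ 14 ∷ 11 ∷ 8 ∷ 54 ∷ 64 ∷ 6 ∷ 27 ∷ 58 ∷ 29 ∷ 26 ∷ 44 ∷ 62 ∷ 43 ∷ 40 ∷ 38 ∷ 41 ∷ 48 ∷ 12 ∷ 50 ∷ 15 ∷ 37 ∷ 30 ∷ [])
  ; T-table =
      (0 ∷ 2 ∷ 3 ∷ 53 ∷ 5 ∷ 6 ∷ 4 ∷ 8 ∷ 9 ∷ 23 ∷ 11 ∷ 12 ∷ 10 ∷ 14 ∷ 15 ∷ 50 ∷ 16 ∷ 18 ∷ 19 ∷ 45 ∷ 21 ∷ 22 ∷ 20 ∷ 24 ∷
       38 ∷ 26 ∷ 27 ∷ 25 ∷ 29 ∷ 30 ∷ 58 ∷ 31 ∷ 33 ∷ 34 ∷ 66 ∷ 36 ∷ 37 ∷ 35 ∷ 7 ∷ 40 ∷ 41 ∷ 39 ∷ 43 ∷ 44 ∷ 62 ∷ 65 ∷ 47 ∷ 48 ∷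
       70 ∷ 13 ∷ 51 ∷ 52 ∷ 42 ∷ 56 ∷ 55 ∷ 46 ∷ 57 ∷ 32 ∷ 59 ∷ 49 ∷ 60 ∷ 1 ∷ 63 ∷ 64 ∷ 28 ∷ 61 ∷ 67 ∷ 68 ∷ 17 ∷ 69 ∷ 54 ∷ 71 ∷ [])
  }

certificate₆ : Certificate
certificate₆ = record
  { n = 72 ; base = 0 ; level = 18
  ; α = 19 ; β = -774 ; γ = 72 ; δ = -2933
  ; S-table =
      (3 ∷ 23 ∷ 39 ∷ 52 ∷ 54 ∷ 6 ∷ 34 ∷ 61 ∷ 9 ∷ 11 ∷ 63 ∷ 62 ∷ 41 ∷ 14 ∷ 42 ∷ 40 ∷ 1 ∷ 18 ∷ 12 ∷ 10 ∷ 7 ∷ 4 ∷ 2 ∷ 53 ∷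
       56 ∷ 26 ∷ 49 ∷ 70 ∷ 29 ∷ 31 ∷ 60 ∷ 71 ∷ 5 ∷ 20 ∷ 32 ∷ 30 ∷ 27 ∷ 24 ∷ 0 ∷ 55 ∷ 57 ∷ 17 ∷ 65 ∷ 44 ∷ 46 ∷ 67 ∷ 66 ∷ 25 ∷
       36 ∷ 47 ∷ 45 ∷ 37 ∷ 38 ∷ 16 ∷ 58 ∷ 22 ∷ 51 ∷ 68 ∷ 21 ∷ 35 ∷ 59 ∷ 33 ∷ 8 ∷ 64 ∷ 19 ∷ 13 ∷ 43 ∷ 69 ∷ 15 ∷ 50 ∷ 48 ∷ 28 ∷ [])
  ; T-table =
      (1 ∷ 2 ∷ 0 ∷ 4 ∷ 5 ∷ 60 ∷ 7 ∷ 8 ∷ 17 ∷ 10 ∷ 9 ∷ 12 ∷ 13 ∷ 46 ∷ 15 ∷ 16 ∷ 51 ∷ 42 ∷ 19 ∷ 20 ∷ 21 ∷ 22 ∷ 68 ∷ 24 ∷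
       25 ∷ 67 ∷ 27 ∷ 28 ∷ 6 ∷ 30 ∷ 29 ∷ 32 ∷ 33 ∷ 11 ∷ 35 ∷ 36 ∷ 37 ∷ 38 ∷ 58 ∷ 40 ∷ 41 ∷ 63 ∷ 43 ∷ 26 ∷ 45 ∷ 44 ∷ 47 ∷ 48 ∷
       31 ∷ 50 ∷ 14 ∷ 49 ∷ 53 ∷ 55 ∷ 39 ∷ 52 ∷ 3 ∷ 23 ∷ 34 ∷ 71 ∷ 70 ∷ 54 ∷ 64 ∷ 61 ∷ 62 ∷ 57 ∷ 69 ∷ 65 ∷ 18 ∷ 66 ∷ 56 ∷ 59 ∷ [])
  }

certificate₇ : Certificate
certificate₇ = record
  { n = 72 ; base = 0 ; level = 18
  ; α = 19 ; β = -774 ; γ = 72 ; δ = -2933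
  ; S-table =
      (1 ∷ 2 ∷ 3 ∷ 0 ∷ 17 ∷ 6 ∷ 19 ∷ 16 ∷ 9 ∷ 22 ∷ 15 ∷ 51 ∷ 64 ∷ 65 ∷ 25 ∷ 39 ∷ 21 ∷ 18 ∷ 59 ∷ 20 ∷ 5 ∷ 61 ∷ 38 ∷ 24 ∷
       30 ∷ 63 ∷ 33 ∷ 68 ∷ 69 ∷ 27 ∷ 62 ∷ 26 ∷ 13 ∷ 34 ∷ 31 ∷ 29 ∷ 37 ∷ 28 ∷ 8 ∷ 60 ∷ 41 ∷ 11 ∷ 43 ∷ 12 ∷ 54 ∷ 70 ∷ 71 ∷ 45 ∷
       49 ∷ 66 ∷ 44 ∷ 40 ∷ 32 ∷ 48 ∷ 55 ∷ 50 ∷ 47 ∷ 58 ∷ 46 ∷ 4 ∷ 10 ∷ 7 ∷ 23 ∷ 67 ∷ 42 ∷ 52 ∷ 53 ∷ 14 ∷ 35 ∷ 36 ∷ 56 ∷ 57 ∷ [])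
  ; T-table =
      (0 ∷ 18 ∷ 2 ∷ 4 ∷ 5 ∷ 15 ∷ 7 ∷ 8 ∷ 30 ∷ 10 ∷ 11 ∷ 12 ∷ 13 ∷ 14 ∷ 9 ∷ 16 ∷ 17 ∷ 3 ∷ 19 ∷ 60 ∷ 21 ∷ 22 ∷ 23 ∷ 33 ∷
       25 ∷ 26 ∷ 27 ∷ 28 ∷ 29 ∷ 24 ∷ 31 ∷ 32 ∷ 53 ∷ 65 ∷ 35 ∷ 36 ∷ 68 ∷ 37 ∷ 39 ∷ 40 ∷ 42 ∷ 6 ∷ 52 ∷ 44 ∷ 45 ∷ 46 ∷ 47 ∷ 48 ∷
       43 ∷ 50 ∷ 51 ∷ 20 ∷ 63 ∷ 54 ∷ 41 ∷ 56 ∷ 57 ∷ 70 ∷ 58 ∷ 1 ∷ 61 ∷ 59 ∷ 67 ∷ 38 ∷ 55 ∷ 49 ∷ 64 ∷ 34 ∷ 62 ∷ 69 ∷ 66 ∷ 71 ∷ [])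
  }

certificate₈ : Certificate
certificate₈ = record
  { n = 72 ; base = 0 ; level = 18
  ; α = 19 ; β = -774 ; γ = 72 ; δ = -2933
  ; S-table =
      (3 ∷ 17 ∷ 31 ∷ 46 ∷ 48 ∷ 6 ∷ 9 ∷ 54 ∷ 57 ∷ 53 ∷ 56 ∷ 7 ∷ 4 ∷ 2 ∷ 15 ∷ 10 ∷ 8 ∷ 47 ∷ 50 ∷ 20 ∷ 23 ∷ 61 ∷ 64 ∷ 60 ∷
       63 ∷ 21 ∷ 18 ∷ 0 ∷ 29 ∷ 24 ∷ 22 ∷ 49 ∷ 51 ∷ 34 ∷ 37 ∷ 67 ∷ 70 ∷ 66 ∷ 69 ∷ 35 ∷ 32 ∷ 1 ∷ 26 ∷ 44 ∷ 38 ∷ 36 ∷ 27 ∷ 41 ∷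
       52 ∷ 13 ∷ 42 ∷ 59 ∷ 12 ∷ 5 ∷ 55 ∷ 11 ∷ 14 ∷ 58 ∷ 16 ∷ 40 ∷ 19 ∷ 62 ∷ 25 ∷ 28 ∷ 65 ∷ 30 ∷ 33 ∷ 68 ∷ 39 ∷ 43 ∷ 71 ∷ 45 ∷ [])
  ; T-table =
      (1 ∷ 2 ∷ 0 ∷ 4 ∷ 5 ∷ 14 ∷ 7 ∷ 8 ∷ 6 ∷ 10 ∷ 11 ∷ 12 ∷ 13 ∷ 59 ∷ 54 ∷ 16 ∷ 15 ∷ 18 ∷ 19 ∷ 28 ∷ 21 ∷ 22 ∷ 20 ∷ 24 ∷
       25 ∷ 26 ∷ 27 ∷ 52 ∷ 61 ∷ 30 ∷ 29 ∷ 32 ∷ 33 ∷ 43 ∷ 35 ∷ 36 ∷ 34 ∷ 38 ∷ 39 ∷ 40 ∷ 41 ∷ 42 ∷ 23 ∷ 67 ∷ 45 ∷ 44 ∷ 47 ∷ 49 ∷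
       31 ∷ 46 ∷ 3 ∷ 17 ∷ 9 ∷ 55 ∷ 48 ∷ 58 ∷ 57 ∷ 56 ∷ 53 ∷ 37 ∷ 62 ∷ 50 ∷ 65 ∷ 64 ∷ 63 ∷ 60 ∷ 68 ∷ 51 ∷ 71 ∷ 70 ∷ 69 ∷ 66 ∷ [])
  }

mainTheorem1 : (i : Fin 8) → Noncongruence (Γgens i)
mainTheorem1 Fin.zero = certified certificate₁
mainTheorem1 (Fin.suc Fin.zero) = certified certificate₂
mainTheorem1 (Fin.suc (Fin.suc Fin.zero)) = certified certificate₃
mainTheorem1 (Fin.suc (Fin.suc (Fin.suc Fin.zero))) = certified certificate₄
mainTheorem1 (Fin.suc (Fin.suc (Fin.suc (Fin.suc Fin.zero)))) = certified certificate₅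
mainTheorem1 (Fin.suc (Fin.suc (Fin.suc (Fin.suc (Fin.suc Fin.zero))))) = certified certificate₆
mainTheorem1 (Fin.suc (Fin.suc (Fin.suc (Fin.suc (Fin.suc (Fin.suc Fin.zero)))))) = certified certificate₇
mainTheorem1 (Fin.suc (Fin.suc (Fin.suc (Fin.suc (Fin.suc (Fin.suc (Fin.suc Fin.zero))))))) = certified certificate₈
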